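{- Let $n\ge2$ and integers $k,m\ge0$, and let $Q^{k,m}=\int_{x_1}^{x_2}t^k\prod_{i=1}^n(t-x_i)^m\,dt$. Expand $Q^{k,m}$ as a polynomial in the variables $x_1,x_3,\dots,x_n,z$ where $z=x_2-x_1$. Then for every integer $r\ge m+1$ the coefficient of $z^r$ in $Q^{k,m}$ is $$\frac{m!}{r(r-1)\cdots(r-m)}\sum_{i_3=0}^m\cdots\sum_{i_n=0}^m(-1)^{m+i_3+\dots+i_n}\binom{m}{i_3}\cdots\binom{m}{i_n}\binom{K}{r-(2m+1)}x_1^{K-(r-(2m+1))}x_3^{i_3}\cdots x_n^{i_n},$$ where $K=k+m(n-2)-i_3-\dots-i_n$, and $\binom{a}{b}=0$ when $b<0$ or $b>a$.
   Context: $Q^{k,m}$ is the polynomial $Q_T^{k,m}$ for the standard tableau $T$ of shape $[n-1,1]$ with entry $2$ in its second row. -}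

module Defs where

open import Data.Nat as ℕ using (ℕ; zero; suc; _∸_; _<?_)
open import Data.Nat.Combinatorics using (_C_; _P_)
open import Data.Nat.Base using (_!)
open import Data.Integer as ℤ using (+_)
open import Data.Rational as ℚ using (ℚ; 0ℚ; 1ℚ; _/_)
open import Data.List as List using (List; []; _∷_)
open import Data.Vec as Vec using (Vec; []; _∷_)
open import Relation.Nullary using (yes; no)

-- Dense univariate polynomials over a carrier A, as coefficient lists
-- (constant term first), with the ring operations induced from A.

module PolyOps {A : Set} (0# : A) (_+ₐ_ _*ₐ_ : A → A → A) (-ₐ_ : A → A) where

  Poly : Set
  Poly = List A

  infixl 6 _⊕_
  infixl 7 _⊗_

  _⊕_ : Poly → Poly → Poly
  []      ⊕ q       = q
  (a ∷ p) ⊕ []      = a ∷ p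
  (a ∷ p) ⊕ (b ∷ q) = (a +ₐ b) ∷ (p ⊕ q)

  scale : A → Poly → Poly
  scale a = List.map (a *ₐ_)

  neg : Poly → Poly
  neg = List.map -ₐ_

  _⊗_ : Poly → Poly → Poly
  []      ⊗ q = []
  (a ∷ p) ⊗ q = scale a q ⊕ (0# ∷ (p ⊗ q))

  pow : Poly → Poly → ℕ → Poly
  pow one p zero    = one
  pow one p (suc e) = p ⊗ pow one p e

  eval : Poly → A → A
  eval []      x = 0#
  eval (a ∷ p) x = a +ₐ (x *ₐ eval p x)

  coeff : ℕ → Poly → A
  coeff r       []      = 0#
  coeff zero    (a ∷ p) = a
  coeff (suc r) (a ∷ p) = coeff r p

module PZ = PolyOps 0ℚ ℚ._+_ ℚ._*_ ℚ.-_
open PZ public using () renaming (Poly to PolyZ)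

-- Polynomials in t whose coefficients are polynomials in z
module PT = PolyOps {PolyZ} [] PZ._⊕_ PZ._⊗_ PZ.neg

-- 1/(n) as a rational (used only for n ≠ 0)
invℕ : ℕ → ℚ
invℕ zero    = 0ℚ
invℕ (suc n) = + 1 / suc n

integFrom : ℕ → PT.Poly → PT.Poly
integFrom j []      = []
integFrom j (c ∷ p) = PZ.scale (invℕ (suc j)) c ∷ integFrom (suc j) p

antideriv : PT.Poly → PT.Poly
antideriv p = [] ∷ integFrom 0 p

constZ : ℚ → PolyZ
constZ a = a ∷ []

oneT : PT.Poly
oneT = constZ 1ℚ ∷ []

tT : PT.Poly
tT = [] ∷ constZ 1ℚ ∷ []

t-minus : PolyZ → PT.Poly
t-minus c = PZ.neg c ∷ constZ 1ℚ ∷ []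

-- x₂ = x₁ + z as a polynomial in z
x2Z : ℚ → PolyZ
x2Z x1 = x1 ∷ 1ℚ ∷ []

prodFactors : ∀ {l} → ℕ → Vec ℚ l → PT.Poly
prodFactors m []       = oneT
prodFactors m (x ∷ xs) = PT.pow oneT (t-minus (constZ x)) m PT.⊗ prodFactors m xs

-- integrand  t^k ∏_{i=1}^n (t - x_i)^m  with x₂ = x₁ + z and
-- (x₃,…,xₙ) = xs
integrand : ∀ {l} → ℕ → ℕ → ℚ → Vec ℚ l → PT.Poly
integrand k m x1 xs =
  PT.pow oneT tT k PT.⊗
  (PT.pow oneT (t-minus (constZ x1)) m PT.⊗
  (PT.pow oneT (t-minus (x2Z x1)) m PT.⊗ prodFactors m xs))

-- Q^{k,m} = ∫_{x₁}^{x₂} integrand dt = F(x₂) - F(x₁), as a polynomial in z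
Q : ∀ {l} → ℕ → ℕ → ℚ → Vec ℚ l → PolyZ
Q k m x1 xs =
  let F = antideriv (integrand k m x1 xs) in
  PT.eval F (x2Z x1) PZ.⊕ PZ.neg (PT.eval F (constZ x1))

powℚ : ℚ → ℕ → ℚ
powℚ x zero    = 1ℚ
powℚ x (suc e) = x ℚ.* powℚ x e

ℕ→ℚ : ℕ → ℚ
ℕ→ℚ a = + a / 1

-- binomial (a choose (r - (2m+1))), zero when r - (2m+1) < 0
-- (and, by _C_, zero when r - (2m+1) > a)
binomShift : ℕ → ℕ → ℕ → ℕ
binomShift a r m with r <? suc (2 ℕ.* m)
... | yes _ = 0
... | no  _ = a C (r ∸ suc (2 ℕ.* m))

sumTo : ℕ → (ℕ → ℚ) → ℚ
sumTo m f = List.foldr ℚ._+_ 0ℚ (List.map f (List.upTo (suc m)))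

sumTuples : (l m : ℕ) → (Vec ℕ l → ℚ) → ℚ
sumTuples zero    m f = f []
sumTuples (suc l) m f = sumTo m (λ i → sumTuples l m (λ is → f (i ∷ is)))

sign : ℕ → ℚ
sign e = powℚ (ℚ.- 1ℚ) e

summand : ∀ {l} → ℕ → ℕ → ℕ → ℚ → Vec ℚ l → Vec ℕ l → ℚ
summand {l} k m r x1 xs is =
  let S = Vec.sum is
      K = (k ℕ.+ m ℕ.* l) ∸ S
  in sign (m ℕ.+ S)
     ℚ.* (ℕ→ℚ (Vec.foldr _ ℕ._*_ 1 (Vec.map (m C_) is))
     ℚ.* (ℕ→ℚ (binomShift K r m)
     ℚ.* (powℚ x1 (K ∸ (r ∸ suc (2 ℕ.* m)))
     ℚ.* Vec.foldr _ ℚ._*_ 1ℚ (Vec.zipWith powℚ xs is))))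

-- m! / (r (r-1) ⋯ (r-m)) · Σ … ; note r P (m+1) = r(r-1)⋯(r-m)
rhs : ∀ {l} → ℕ → ℕ → ℕ → ℚ → Vec ℚ l → ℚ
rhs {l} k m r x1 xs =
  (ℕ→ℚ (m !) ℚ.* invℕ (r P suc m)) ℚ.* sumTuples l m (summand k m r x1 xs)

-- Substituting t = x₁ + s turns Q^{k,m} into ∫₀^z h(s) ds with
-- h(s) = s^m (s - z)^m (x₁ + s)^k ∏_{j≥3} (x₁ + s - x_j)^m; the substitution is justified by
-- comparing formal derivatives. Expanding (s - z)^m binomially and (x₁ + s)^k ∏_j (x₁ + s - x_j)^m
-- in powers s^p, the terms with a fixed p integrate to multiples of z^(2m+1+p), and the sum over
-- the binomial index is the Beta integral Σ_a C(m,a) (-1)^a / (m+p+1+a) = m! / ((m+p+1) ⋯ (2m+p+1)).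
-- Finally, polynomials over ℚ with the same values have the same coefficients (they cannot differ
-- by a nonzero constant term near 0), which turns this identity of values into the coefficient formula.

module Submission where

open import Defs
open import Data.Nat as ℕ using (ℕ; zero; suc; z≤n; s≤s; _≤_; _!)
import Data.Nat.Properties as ℕP
open import Data.Nat.Tactic.RingSolver using (solve-∀)
open import Data.Nat.Combinatorics using (_C_; _P_; k>n⇒nCk≡0; nCk+nC[k+1]≡[n+1]C[k+1])
open import Data.Nat.Combinatorics.Base using (_P′_)
open import Data.Bool using (true; if_then_else_) renaming (T to True)
import Data.Integer as ℤ
import Data.Integer.Properties as ℤP
import Data.Nat.Coprimality as Coprime
open import Data.Rational as ℚ using (ℚ; 0ℚ; 1ℚ; mkℚ; _+_; _*_; -_; _-_; ∣_∣)
import Data.Rational.Properties as ℚP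
open import Data.Rational.Solver using (module +-*-Solver)
open import Data.List as List using (List; []; _∷_)
open import Data.Vec as Vec using (Vec; []; _∷_)
open import Data.Vec.Relation.Unary.All using (All; []; _∷_)
open import Function using (_∘_)
open import Relation.Nullary using (yes; no; contradiction)
open import Relation.Binary.PropositionalEquality
  using (_≡_; _≢_; refl; sym; trans; cong; cong₂; subst; subst₂; module ≡-Reasoning)
open ≡-Reasoning
open +-*-Solver
open PZ using (_⊕_; _⊗_; scale; neg; pow; eval; coeff)

ℕ→ℚ≡mkℚ : ∀ a → ℕ→ℚ a ≡ mkℚ (ℤ.+ a) 0 (Coprime.sym (Coprime.1-coprimeTo a))
ℕ→ℚ≡mkℚ a = ℚP.↥p/↧p≡p (mkℚ (ℤ.+ a) 0 (Coprime.sym (Coprime.1-coprimeTo a)))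

ℕ→ℚ-+ : ∀ a b → ℕ→ℚ (a ℕ.+ b) ≡ ℕ→ℚ a + ℕ→ℚ b
ℕ→ℚ-+ a b = begin
  ℕ→ℚ (a ℕ.+ b)
    ≡⟨ ℚP./-cong (cong₂ ℤ._+_ (sym (ℤP.*-identityʳ (ℤ.+ a))) (sym (ℤP.*-identityʳ (ℤ.+ b)))) refl ⟩
  (ℤ.+ a ℤ.* ℤ.+ 1 ℤ.+ ℤ.+ b ℤ.* ℤ.+ 1) ℚ./ 1
    ≡⟨ sym (cong₂ _+_ (ℕ→ℚ≡mkℚ a) (ℕ→ℚ≡mkℚ b)) ⟩
  ℕ→ℚ a + ℕ→ℚ b ∎

ℕ→ℚ-* : ∀ a b → ℕ→ℚ (a ℕ.* b) ≡ ℕ→ℚ a * ℕ→ℚ b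
ℕ→ℚ-* a b = begin
  ℕ→ℚ (a ℕ.* b)              ≡⟨ ℚP./-cong (sym (ℤP.+◃n≡+n (a ℕ.* b))) refl ⟩
  (ℤ.+ a ℤ.* ℤ.+ b) ℚ./ 1    ≡⟨ sym (cong₂ _*_ (ℕ→ℚ≡mkℚ a) (ℕ→ℚ≡mkℚ b)) ⟩
  ℕ→ℚ a * ℕ→ℚ b              ∎

invℕ-inverseˡ : ∀ n → invℕ (suc n) * ℕ→ℚ (suc n) ≡ 1ℚ
invℕ-inverseˡ n = trans
  (cong₂ _*_ (ℚP.↥p/↧p≡p (mkℚ (ℤ.+ 1) n (Coprime.1-coprimeTo (suc n)))) (ℕ→ℚ≡mkℚ (suc n)))
  (ℚP.*-inverseˡ (mkℚ (ℤ.+ suc n) 0 (Coprime.sym (Coprime.1-coprimeTo (suc n)))))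

invℕ-inverseʳ : ∀ n → ℕ→ℚ (suc n) * invℕ (suc n) ≡ 1ℚ
invℕ-inverseʳ n = trans (ℚP.*-comm (ℕ→ℚ (suc n)) (invℕ (suc n))) (invℕ-inverseˡ n)

inverse-unique : ∀ a x y → a * x ≡ 1ℚ → y * a ≡ 1ℚ → x ≡ y
inverse-unique a x y ax≡1 ya≡1 = begin
  x              ≡⟨ sym (ℚP.*-identityˡ x) ⟩
  1ℚ * x         ≡⟨ cong (_* x) (sym ya≡1) ⟩
  (y * a) * x    ≡⟨ ℚP.*-assoc y a x ⟩
  y * (a * x)    ≡⟨ cong (y *_) ax≡1 ⟩
  y * 1ℚ         ≡⟨ ℚP.*-identityʳ y ⟩
  y              ∎

invℕ-* : ∀ a b → invℕ (a ℕ.* b) ≡ invℕ a * invℕ b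
invℕ-* zero    b       = sym (ℚP.*-zeroˡ (invℕ b))
invℕ-* (suc a) zero    = trans (cong invℕ (ℕP.*-zeroʳ a)) (sym (ℚP.*-zeroʳ (invℕ (suc a))))
invℕ-* (suc a) (suc b) =
  sym (inverse-unique (ℕ→ℚ (suc a ℕ.* suc b)) _ _ ab*ia*ib≡1 (invℕ-inverseˡ (b ℕ.+ a ℕ.* suc b)))
  where
  ab*ia*ib≡1 : ℕ→ℚ (suc a ℕ.* suc b) * (invℕ (suc a) * invℕ (suc b)) ≡ 1ℚ
  ab*ia*ib≡1 = begin
    ℕ→ℚ (suc a ℕ.* suc b) * (invℕ (suc a) * invℕ (suc b))
      ≡⟨ cong (_* (invℕ (suc a) * invℕ (suc b))) (ℕ→ℚ-* (suc a) (suc b)) ⟩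
    (ℕ→ℚ (suc a) * ℕ→ℚ (suc b)) * (invℕ (suc a) * invℕ (suc b))
      ≡⟨ solve 4 (λ A B iA iB → (A :* B) :* (iA :* iB) := (A :* iA) :* (B :* iB)) refl
                 (ℕ→ℚ (suc a)) (ℕ→ℚ (suc b)) (invℕ (suc a)) (invℕ (suc b)) ⟩
    (ℕ→ℚ (suc a) * invℕ (suc a)) * (ℕ→ℚ (suc b) * invℕ (suc b))
      ≡⟨ cong₂ _*_ (invℕ-inverseʳ a) (invℕ-inverseʳ b) ⟩
    1ℚ ∎

ℕ→ℚ-suc-cancelˡ : ∀ n x → ℕ→ℚ (suc n) * x ≡ 0ℚ → x ≡ 0ℚ
ℕ→ℚ-suc-cancelˡ n x nx≡0 = begin
  x                                  ≡⟨ sym (ℚP.*-identityˡ x) ⟩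
  1ℚ * x                             ≡⟨ cong (_* x) (sym (invℕ-inverseˡ n)) ⟩
  invℕ (suc n) * ℕ→ℚ (suc n) * x     ≡⟨ ℚP.*-assoc (invℕ (suc n)) _ x ⟩
  invℕ (suc n) * (ℕ→ℚ (suc n) * x)   ≡⟨ cong (invℕ (suc n) *_) nx≡0 ⟩
  invℕ (suc n) * 0ℚ                  ≡⟨ ℚP.*-zeroʳ (invℕ (suc n)) ⟩
  0ℚ                                 ∎

Σ : ℕ → (ℕ → ℚ) → ℚ
Σ zero    f = 0ℚ
Σ (suc n) f = f 0 + Σ n (λ i → f (suc i))

Σ-cong< : ∀ n {f g : ℕ → ℚ} → (∀ i → i ℕ.< n → f i ≡ g i) → Σ n f ≡ Σ n g
Σ-cong< zero    f≡g = refl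
Σ-cong< (suc n) f≡g = cong₂ _+_ (f≡g 0 (s≤s z≤n)) (Σ-cong< n (λ i i<n → f≡g (suc i) (s≤s i<n)))

Σ-cong : ∀ n {f g : ℕ → ℚ} → (∀ i → f i ≡ g i) → Σ n f ≡ Σ n g
Σ-cong n f≡g = Σ-cong< n (λ i _ → f≡g i)

Σ-zero : ∀ n {f : ℕ → ℚ} → (∀ i → i ℕ.< n → f i ≡ 0ℚ) → Σ n f ≡ 0ℚ
Σ-zero zero    f≡0 = refl
Σ-zero (suc n) f≡0 = cong₂ _+_ (f≡0 0 (s≤s z≤n)) (Σ-zero n (λ i i<n → f≡0 (suc i) (s≤s i<n)))

Σ-+ : ∀ n (f g : ℕ → ℚ) → Σ n (λ i → f i + g i) ≡ Σ n f + Σ n g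
Σ-+ zero    f g = refl
Σ-+ (suc n) f g = begin
  (f 0 + g 0) + Σ n (λ i → f (suc i) + g (suc i))
    ≡⟨ cong ((f 0 + g 0) +_) (Σ-+ n (λ i → f (suc i)) (λ i → g (suc i))) ⟩
  (f 0 + g 0) + (Σ n (λ i → f (suc i)) + Σ n (λ i → g (suc i)))
    ≡⟨ solve 4 (λ a b c d → (a :+ b) :+ (c :+ d) := (a :+ c) :+ (b :+ d)) refl (f 0) (g 0) _ _ ⟩
  (f 0 + Σ n (λ i → f (suc i))) + (g 0 + Σ n (λ i → g (suc i))) ∎

Σ-neg : ∀ n (f : ℕ → ℚ) → Σ n (λ i → - f i) ≡ - Σ n f
Σ-neg zero    f = refl
Σ-neg (suc n) f = trans (cong (- f 0 +_) (Σ-neg n (λ i → f (suc i)))) (sym (ℚP.neg-distrib-+ (f 0) _))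

*-distribˡ-Σ : ∀ n c (f : ℕ → ℚ) → c * Σ n f ≡ Σ n (λ i → c * f i)
*-distribˡ-Σ zero    c f = ℚP.*-zeroʳ c
*-distribˡ-Σ (suc n) c f =
  trans (ℚP.*-distribˡ-+ c (f 0) _) (cong (c * f 0 +_) (*-distribˡ-Σ n c (λ i → f (suc i))))

*-distribʳ-Σ : ∀ n c (f : ℕ → ℚ) → Σ n f * c ≡ Σ n (λ i → f i * c)
*-distribʳ-Σ n c f =
  trans (ℚP.*-comm (Σ n f) c) (trans (*-distribˡ-Σ n c f) (Σ-cong n (λ i → ℚP.*-comm c (f i))))

Σ-comm : ∀ n m (f : ℕ → ℕ → ℚ) → Σ n (λ i → Σ m (f i)) ≡ Σ m (λ j → Σ n (λ i → f i j))
Σ-comm zero    m f = sym (Σ-zero m (λ _ _ → refl))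
Σ-comm (suc n) m f = trans (cong (Σ m (f 0) +_) (Σ-comm n m (λ i → f (suc i))))
                           (sym (Σ-+ m (f 0) (λ j → Σ n (λ i → f (suc i) j))))

Σ-last : ∀ n (f : ℕ → ℚ) → Σ (suc n) f ≡ Σ n f + f n
Σ-last zero    f = trans (ℚP.+-identityʳ (f 0)) (sym (ℚP.+-identityˡ (f 0)))
Σ-last (suc n) f = trans (cong (f 0 +_) (Σ-last n (λ i → f (suc i)))) (sym (ℚP.+-assoc (f 0) _ _))

Σ-split : ∀ a b (f : ℕ → ℚ) → Σ (a ℕ.+ b) f ≡ Σ a f + Σ b (λ i → f (a ℕ.+ i))
Σ-split zero    b f = sym (ℚP.+-identityˡ _)
Σ-split (suc a) b f = trans (cong (f 0 +_) (Σ-split a b (λ i → f (suc i)))) (sym (ℚP.+-assoc (f 0) _ _))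

Σ-extend : ∀ n d (f : ℕ → ℚ) → (∀ i → f (n ℕ.+ i) ≡ 0ℚ) → Σ (n ℕ.+ d) f ≡ Σ n f
Σ-extend n d f tail≡0 = begin
  Σ (n ℕ.+ d) f                        ≡⟨ Σ-split n d f ⟩
  Σ n f + Σ d (λ i → f (n ℕ.+ i))      ≡⟨ cong (Σ n f +_) (Σ-zero d (λ i _ → tail≡0 i)) ⟩
  Σ n f + 0ℚ                           ≡⟨ ℚP.+-identityʳ (Σ n f) ⟩
  Σ n f                                ∎

sumTo≡Σ : ∀ m f → sumTo m f ≡ Σ (suc m) f
sumTo≡Σ m f = foldr-applyUpTo (suc m) f (λ i → i)
  where
  foldr-applyUpTo : ∀ n (f : ℕ → ℚ) (g : ℕ → ℕ) →
    List.foldr _+_ 0ℚ (List.map f (List.applyUpTo g n)) ≡ Σ n (λ i → f (g i))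
  foldr-applyUpTo zero    f g = refl
  foldr-applyUpTo (suc n) f g = cong (f (g 0) +_) (foldr-applyUpTo n f (λ i → g (suc i)))

sumTuples-suc : ∀ l m (F : Vec ℕ (suc l) → ℚ) →
  sumTuples (suc l) m F ≡ Σ (suc m) (λ i → sumTuples l m (λ is → F (i ∷ is)))
sumTuples-suc l m F = sumTo≡Σ m (λ i → sumTuples l m (λ is → F (i ∷ is)))

sumTuples-cong≤ : ∀ l m {F G : Vec ℕ l → ℚ} →
  (∀ is → All (ℕ._≤ m) is → F is ≡ G is) → sumTuples l m F ≡ sumTuples l m G
sumTuples-cong≤ zero    m F≡G = F≡G [] []
sumTuples-cong≤ (suc l) m {F} {G} F≡G = begin
  sumTuples (suc l) m F                              ≡⟨ sumTuples-suc l m F ⟩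
  Σ (suc m) (λ i → sumTuples l m (λ is → F (i ∷ is)))
    ≡⟨ Σ-cong< (suc m) (λ i i<1+m → sumTuples-cong≤ l m (λ is is≤m → F≡G (i ∷ is) (ℕP.≤-pred i<1+m ∷ is≤m))) ⟩
  Σ (suc m) (λ i → sumTuples l m (λ is → G (i ∷ is))) ≡⟨ sumTuples-suc l m G ⟨
  sumTuples (suc l) m G                              ∎

sumTuples-cong : ∀ l m {F G : Vec ℕ l → ℚ} → (∀ is → F is ≡ G is) → sumTuples l m F ≡ sumTuples l m G
sumTuples-cong l m F≡G = sumTuples-cong≤ l m (λ is _ → F≡G is)

sumTuples-zero : ∀ l m (F : Vec ℕ l → ℚ) → (∀ is → F is ≡ 0ℚ) → sumTuples l m F ≡ 0ℚ
sumTuples-zero zero    m F F≡0 = F≡0 []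
sumTuples-zero (suc l) m F F≡0 =
  trans (sumTuples-suc l m F) (Σ-zero (suc m) (λ i _ → sumTuples-zero l m _ (λ is → F≡0 (i ∷ is))))

*-distribˡ-sumTuples : ∀ l m c (F : Vec ℕ l → ℚ) →
  c * sumTuples l m F ≡ sumTuples l m (λ is → c * F is)
*-distribˡ-sumTuples zero    m c F = refl
*-distribˡ-sumTuples (suc l) m c F = begin
  c * sumTuples (suc l) m F                                  ≡⟨ cong (c *_) (sumTuples-suc l m F) ⟩
  c * Σ (suc m) (λ i → sumTuples l m (λ is → F (i ∷ is)))    ≡⟨ *-distribˡ-Σ (suc m) c (λ i → sumTuples l m (λ is → F (i ∷ is))) ⟩
  Σ (suc m) (λ i → c * sumTuples l m (λ is → F (i ∷ is)))
    ≡⟨ Σ-cong (suc m) (λ i → *-distribˡ-sumTuples l m c (λ is → F (i ∷ is))) ⟩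
  Σ (suc m) (λ i → sumTuples l m (λ is → c * F (i ∷ is)))    ≡⟨ sumTuples-suc l m (λ is → c * F is) ⟨
  sumTuples (suc l) m (λ is → c * F is)                      ∎

sumTuples-Σ-comm : ∀ l m n (F : Vec ℕ l → ℕ → ℚ) →
  sumTuples l m (λ is → Σ n (F is)) ≡ Σ n (λ p → sumTuples l m (λ is → F is p))
sumTuples-Σ-comm zero    m n F = refl
sumTuples-Σ-comm (suc l) m n F = begin
  sumTuples (suc l) m (λ is → Σ n (F is))
    ≡⟨ sumTuples-suc l m (λ is → Σ n (F is)) ⟩
  Σ (suc m) (λ i → sumTuples l m (λ is → Σ n (F (i ∷ is))))
    ≡⟨ Σ-cong (suc m) (λ i → sumTuples-Σ-comm l m n (λ is → F (i ∷ is))) ⟩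
  Σ (suc m) (λ i → Σ n (λ p → sumTuples l m (λ is → F (i ∷ is) p)))
    ≡⟨ Σ-comm (suc m) n (λ i p → sumTuples l m (λ is → F (i ∷ is) p)) ⟩
  Σ n (λ p → Σ (suc m) (λ i → sumTuples l m (λ is → F (i ∷ is) p)))
    ≡⟨ Σ-cong n (λ p → sumTuples-suc l m (λ is → F is p)) ⟨
  Σ n (λ p → sumTuples (suc l) m (λ is → F is p)) ∎

-- Powers, binomial coefficients and the Beta sum

powℚ-+ : ∀ x a b → powℚ x (a ℕ.+ b) ≡ powℚ x a * powℚ x b
powℚ-+ x zero    b = sym (ℚP.*-identityˡ (powℚ x b))
powℚ-+ x (suc a) b = trans (cong (x *_) (powℚ-+ x a b)) (sym (ℚP.*-assoc x (powℚ x a) (powℚ x b)))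

sign-+ : ∀ a b → sign (a ℕ.+ b) ≡ sign a * sign b
sign-+ = powℚ-+ (- 1ℚ)

sign*sign≡1 : ∀ a → sign a * sign a ≡ 1ℚ
sign*sign≡1 zero    = refl
sign*sign≡1 (suc a) =
  trans (solve 1 (λ s → (:- con 1ℚ :* s) :* (:- con 1ℚ :* s) := s :* s) refl (sign a)) (sign*sign≡1 a)

powℚ-neg : ∀ x n → powℚ (- x) n ≡ sign n * powℚ x n
powℚ-neg x zero    = refl
powℚ-neg x (suc n) = trans (cong (- x *_) (powℚ-neg x n))
  (solve 3 (λ x s p → (:- x) :* (s :* p) := (:- con 1ℚ :* s) :* (x :* p)) refl x (sign n) (powℚ x n))

sign-∸ : ∀ m a → a ≤ m → sign (m ℕ.∸ a) ≡ sign m * sign a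
sign-∸ m a a≤m = begin
  sign (m ℕ.∸ a)                          ≡⟨ sym (ℚP.*-identityʳ _) ⟩
  sign (m ℕ.∸ a) * 1ℚ                     ≡⟨ cong (sign (m ℕ.∸ a) *_) (sym (sign*sign≡1 a)) ⟩
  sign (m ℕ.∸ a) * (sign a * sign a)      ≡⟨ sym (ℚP.*-assoc (sign (m ℕ.∸ a)) (sign a) (sign a)) ⟩
  (sign (m ℕ.∸ a) * sign a) * sign a      ≡⟨ cong (_* sign a) (sym (sign-+ (m ℕ.∸ a) a)) ⟩
  sign (m ℕ.∸ a ℕ.+ a) * sign a           ≡⟨ cong (λ e → sign e * sign a) (ℕP.m∸n+n≡m a≤m) ⟩
  sign m * sign a                         ∎

binomℚ : ℕ → ℕ → ℚ
binomℚ n k = ℕ→ℚ (n C k)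

binomℚ-> : ∀ n k → n ℕ.< k → binomℚ n k ≡ 0ℚ
binomℚ-> n k n<k = cong ℕ→ℚ (k>n⇒nCk≡0 n<k)

Σ-pascal : ∀ n (F : ℕ → ℚ) →
  Σ (suc (suc n)) (λ p → binomℚ (suc n) p * F p) ≡
  Σ (suc n) (λ p → binomℚ n p * F p) + Σ (suc n) (λ p → binomℚ n p * F (suc p))
Σ-pascal n F = begin
  F₀ + Σ (suc n) (λ q → binomℚ (suc n) (suc q) * F (suc q))
    ≡⟨ cong (F₀ +_) (Σ-cong (suc n) pascal) ⟩
  F₀ + Σ (suc n) (λ q → binomℚ n q * F (suc q) + binomℚ n (suc q) * F (suc q))
    ≡⟨ cong (F₀ +_) (Σ-+ (suc n) (λ q → binomℚ n q * F (suc q)) (λ q → binomℚ n (suc q) * F (suc q))) ⟩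
  F₀ + (Y + Σ (suc n) (λ q → binomℚ n (suc q) * F (suc q)))
    ≡⟨ cong (λ e → F₀ + (Y + e)) (Σ-last n (λ q → binomℚ n (suc q) * F (suc q))) ⟩
  F₀ + (Y + (X + binomℚ n (suc n) * F (suc n)))
    ≡⟨ cong (λ e → F₀ + (Y + (X + e * F (suc n)))) (binomℚ-> n (suc n) (ℕP.n<1+n n)) ⟩
  F₀ + (Y + (X + 0ℚ * F (suc n)))
    ≡⟨ solve 4 (λ a y x f → a :+ (y :+ (x :+ con 0ℚ :* f)) := (a :+ x) :+ y) refl F₀ Y X (F (suc n)) ⟩
  (F₀ + X) + Y ∎
  where
  F₀ = binomℚ n 0 * F 0
  X = Σ n (λ q → binomℚ n (suc q) * F (suc q))
  Y = Σ (suc n) (λ p → binomℚ n p * F (suc p))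
  pascal : ∀ q → binomℚ (suc n) (suc q) * F (suc q) ≡ binomℚ n q * F (suc q) + binomℚ n (suc q) * F (suc q)
  pascal q = begin
    binomℚ (suc n) (suc q) * F (suc q)
      ≡⟨ cong (λ e → ℕ→ℚ e * F (suc q)) (sym (nCk+nC[k+1]≡[n+1]C[k+1] n q)) ⟩
    ℕ→ℚ (n C q ℕ.+ n C suc q) * F (suc q)
      ≡⟨ cong (_* F (suc q)) (ℕ→ℚ-+ (n C q) (n C suc q)) ⟩
    (binomℚ n q + binomℚ n (suc q)) * F (suc q)
      ≡⟨ ℚP.*-distribʳ-+ (F (suc q)) (binomℚ n q) (binomℚ n (suc q)) ⟩
    binomℚ n q * F (suc q) + binomℚ n (suc q) * F (suc q) ∎

binomial-theorem : ∀ K x y → powℚ (x + y) K ≡ Σ (suc K) (λ p → binomℚ K p * (powℚ x (K ℕ.∸ p) * powℚ y p))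
binomial-theorem zero    x y = refl
binomial-theorem (suc n) x y = begin
  (x + y) * powℚ (x + y) n                                ≡⟨ cong ((x + y) *_) (binomial-theorem n x y) ⟩
  (x + y) * Σ (suc n) G                                   ≡⟨ ℚP.*-distribʳ-+ (Σ (suc n) G) x y ⟩
  x * Σ (suc n) G + y * Σ (suc n) G                       ≡⟨ cong₂ _+_ (*-distribˡ-Σ (suc n) x G) (*-distribˡ-Σ (suc n) y G) ⟩
  Σ (suc n) (λ p → x * G p) + Σ (suc n) (λ p → y * G p)   ≡⟨ cong₂ _+_ (Σ-cong< (suc n) x-term) (Σ-cong (suc n) y-term) ⟩
  Σ (suc n) (λ p → binomℚ n p * H p) + Σ (suc n) (λ p → binomℚ n p * H (suc p))
    ≡⟨ Σ-pascal n H ⟨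
  Σ (suc (suc n)) (λ p → binomℚ (suc n) p * H p) ∎
  where
  G = λ p → binomℚ n p * (powℚ x (n ℕ.∸ p) * powℚ y p)
  H = λ p → powℚ x (suc n ℕ.∸ p) * powℚ y p
  x-term : ∀ p → p ℕ.< suc n → x * G p ≡ binomℚ n p * H p
  x-term p p<1+n = begin
    x * G p
      ≡⟨ solve 4 (λ x c a b → x :* (c :* (a :* b)) := c :* ((x :* a) :* b)) refl x (binomℚ n p) (powℚ x (n ℕ.∸ p)) (powℚ y p) ⟩
    binomℚ n p * (powℚ x (suc (n ℕ.∸ p)) * powℚ y p)
      ≡⟨ cong (λ e → binomℚ n p * (powℚ x e * powℚ y p)) (sym (ℕP.+-∸-assoc 1 (ℕP.≤-pred p<1+n))) ⟩
    binomℚ n p * H p ∎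
  y-term : ∀ p → y * G p ≡ binomℚ n p * H (suc p)
  y-term p = solve 4 (λ y c a b → y :* (c :* (a :* b)) := c :* (a :* (y :* b))) refl y (binomℚ n p) (powℚ x (n ℕ.∸ p)) (powℚ y p)

binomial-theorem-≤ : ∀ K N x y → K ≤ N →
  powℚ (x + y) K ≡ Σ (suc N) (λ p → binomℚ K p * (powℚ x (K ℕ.∸ p) * powℚ y p))
binomial-theorem-≤ K N x y K≤N = begin
  powℚ (x + y) K                  ≡⟨ binomial-theorem K x y ⟩
  Σ (suc K) f                     ≡⟨ Σ-extend (suc K) (N ℕ.∸ K) f beyond-K ⟨
  Σ (suc K ℕ.+ (N ℕ.∸ K)) f       ≡⟨ cong (λ e → Σ (suc e) f) (ℕP.m+[n∸m]≡n K≤N) ⟩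
  Σ (suc N) f                     ∎
  where
  f = λ p → binomℚ K p * (powℚ x (K ℕ.∸ p) * powℚ y p)
  beyond-K : ∀ i → f (suc K ℕ.+ i) ≡ 0ℚ
  beyond-K i = trans (cong (_* rest) (binomℚ-> K (suc K ℕ.+ i) (s≤s (ℕP.m≤m+n K i)))) (ℚP.*-zeroˡ rest)
    where rest = powℚ x (K ℕ.∸ (suc K ℕ.+ i)) * powℚ y (suc K ℕ.+ i)

rising : ℕ → ℕ → ℕ
rising a zero    = 1
rising a (suc k) = a ℕ.* rising (suc a) k

rising-suc-last : ∀ a k → rising a (suc k) ≡ rising a k ℕ.* (a ℕ.+ k)
rising-suc-last a zero    = trans (ℕP.*-identityʳ a) (sym (trans (ℕP.*-identityˡ (a ℕ.+ 0)) (ℕP.+-identityʳ a)))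
rising-suc-last a (suc k) = begin
  a ℕ.* rising (suc a) (suc k)                 ≡⟨ cong (a ℕ.*_) (rising-suc-last (suc a) k) ⟩
  a ℕ.* (rising (suc a) k ℕ.* (suc a ℕ.+ k))   ≡⟨ sym (ℕP.*-assoc a (rising (suc a) k) _) ⟩
  a ℕ.* rising (suc a) k ℕ.* (suc a ℕ.+ k)     ≡⟨ cong (a ℕ.* rising (suc a) k ℕ.*_) (sym (ℕP.+-suc a k)) ⟩
  a ℕ.* rising (suc a) k ℕ.* (a ℕ.+ suc k)     ∎

rising≡P′ : ∀ k n → rising (suc n) k ≡ (n ℕ.+ k) P′ k
rising≡P′ zero    n = refl
rising≡P′ (suc k) n = begin
  suc n ℕ.* rising (suc (suc n)) k                      ≡⟨ cong₂ ℕ._*_ (ℕP.m+n∸n≡m (suc n) k) (sym (rising≡P′ k (suc n))) ⟨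
  ((suc n ℕ.+ k) ℕ.∸ k) ℕ.* ((suc n ℕ.+ k) P′ k)        ≡⟨⟩
  (suc n ℕ.+ k) P′ suc k                                ≡⟨ cong (_P′ suc k) (ℕP.+-suc n k) ⟨
  (n ℕ.+ suc k) P′ suc k                                ∎

rising≡P : ∀ m p → rising (suc (m ℕ.+ p)) (suc m) ≡ (suc (2 ℕ.* m) ℕ.+ p) P suc m
rising≡P m p = begin
  rising (suc (m ℕ.+ p)) (suc m)          ≡⟨ rising≡P′ (suc m) (m ℕ.+ p) ⟩
  (m ℕ.+ p ℕ.+ suc m) P′ suc m            ≡⟨ cong (_P′ suc m) (top-factor m p) ⟩
  r P′ suc m                              ≡⟨ if-true (ℕP.≤⇒≤ᵇ m+1≤r) ⟨
  r P suc m                               ∎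
  where
  r = suc (2 ℕ.* m) ℕ.+ p
  top-factor : ∀ m p → m ℕ.+ p ℕ.+ suc m ≡ suc (2 ℕ.* m) ℕ.+ p
  top-factor = solve-∀
  m+1≤r : suc m ≤ r
  m+1≤r = s≤s (ℕP.≤-trans (ℕP.m≤m+n m (m ℕ.+ 0)) (ℕP.m≤m+n (2 ℕ.* m) p))
  if-true : ∀ {b} {x y : ℕ} → True b → (if b then x else y) ≡ x
  if-true {true} _ = refl

-- Σ_a C(m,a) (-1)^a / (N + a) = ∫₀¹ t^(N-1) (1 - t)^m dt, the Beta integral B(N, m + 1)
betaSum : ℕ → ℕ → ℚ
betaSum m N = Σ (suc m) (λ a → binomℚ m a * (sign a * invℕ (N ℕ.+ a)))

betaSum-pascal : ∀ m N → betaSum (suc m) (suc N) ≡ betaSum m (suc N) - betaSum m (suc (suc N))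
betaSum-pascal m N = begin
  betaSum (suc m) (suc N)                            ≡⟨ Σ-pascal m F ⟩
  betaSum m (suc N) + Σ (suc m) (λ a → binomℚ m a * F (suc a))
    ≡⟨ cong (betaSum m (suc N) +_) (Σ-cong (suc m) shifted) ⟩
  betaSum m (suc N) + Σ (suc m) (λ a → - (binomℚ m a * (sign a * invℕ (suc (suc N) ℕ.+ a))))
    ≡⟨ cong (betaSum m (suc N) +_) (Σ-neg (suc m) (λ a → binomℚ m a * (sign a * invℕ (suc (suc N) ℕ.+ a)))) ⟩
  betaSum m (suc N) - betaSum m (suc (suc N))        ∎
  where
  F = λ a → sign a * invℕ (suc N ℕ.+ a)
  shifted : ∀ a → binomℚ m a * F (suc a) ≡ - (binomℚ m a * (sign a * invℕ (suc (suc N) ℕ.+ a)))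
  shifted a = trans (cong (λ e → binomℚ m a * (sign (suc a) * invℕ e)) (ℕP.+-suc (suc N) a))
    (solve 3 (λ c s i → c :* ((:- con 1ℚ :* s) :* i) := :- (c :* (s :* i))) refl
             (binomℚ m a) (sign a) (invℕ (suc (suc N) ℕ.+ a)))

betaSum-closed : ∀ m N → betaSum m (suc N) ≡ ℕ→ℚ (m !) * invℕ (rising (suc N) (suc m))
betaSum-closed zero    N = begin
  binomℚ 0 0 * (sign 0 * invℕ (suc N ℕ.+ 0)) + 0ℚ  ≡⟨ cong (λ e → binomℚ 0 0 * (sign 0 * invℕ e) + 0ℚ) (ℕP.+-identityʳ (suc N)) ⟩
  binomℚ 0 0 * (sign 0 * invℕ (suc N)) + 0ℚ        ≡⟨ solve 1 (λ i → con 1ℚ :* (con 1ℚ :* i) :+ con 0ℚ := con 1ℚ :* i) refl (invℕ (suc N)) ⟩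
  ℕ→ℚ 1 * invℕ (suc N)                             ≡⟨ cong (λ e → ℕ→ℚ 1 * invℕ e) (sym (ℕP.*-identityʳ (suc N))) ⟩
  ℕ→ℚ 1 * invℕ (suc N ℕ.* 1)                       ∎
betaSum-closed (suc m) N = begin
  betaSum (suc m) (suc N)                         ≡⟨ betaSum-pascal m N ⟩
  betaSum m (suc N) - betaSum m (suc (suc N))     ≡⟨ cong₂ _-_ (betaSum-closed m N) (betaSum-closed m (suc N)) ⟩
  f * invℕ A - f * invℕ B                         ≡⟨ cong₂ (λ u v → f * u - f * v) invA invB ⟩
  f * (ℕ→ℚ top * iR) - f * (ℕ→ℚ (suc N) * iR)
    ≡⟨ cong (λ e → f * (e * iR) - f * (ℕ→ℚ (suc N) * iR)) (ℕ→ℚ-+ (suc N) (suc m)) ⟩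
  f * ((ℕ→ℚ (suc N) + s) * iR) - f * (ℕ→ℚ (suc N) * iR)
    ≡⟨ solve 4 (λ f c s r → f :* ((c :+ s) :* r) :- f :* (c :* r) := (s :* f) :* r) refl f (ℕ→ℚ (suc N)) s iR ⟩
  (s * f) * iR                                    ≡⟨ cong (_* iR) (sym (ℕ→ℚ-* (suc m) (m !))) ⟩
  ℕ→ℚ (suc m !) * iR                              ∎
  where
  f = ℕ→ℚ (m !)
  s = ℕ→ℚ (suc m)
  A = rising (suc N) (suc m)
  B = rising (suc (suc N)) (suc m)
  top = suc N ℕ.+ suc m
  iR = invℕ (rising (suc N) (suc (suc m)))
  -- rising (N + 1) (m + 2) = A · (N + m + 2) = (N + 1) · B
  invA : invℕ A ≡ ℕ→ℚ top * iR
  invA = begin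
    invℕ A                                   ≡⟨ ℚP.*-identityʳ (invℕ A) ⟨
    invℕ A * 1ℚ                              ≡⟨ cong (invℕ A *_) (invℕ-inverseʳ (N ℕ.+ suc m)) ⟨
    invℕ A * (ℕ→ℚ top * invℕ top)           ≡⟨ solve 3 (λ a c i → a :* (c :* i) := c :* (a :* i)) refl (invℕ A) (ℕ→ℚ top) (invℕ top) ⟩
    ℕ→ℚ top * (invℕ A * invℕ top)           ≡⟨ cong (ℕ→ℚ top *_) (invℕ-* A top) ⟨
    ℕ→ℚ top * invℕ (A ℕ.* top)              ≡⟨ cong (λ e → ℕ→ℚ top * invℕ e) (rising-suc-last (suc N) (suc m)) ⟨
    ℕ→ℚ top * iR                             ∎
  invB : invℕ B ≡ ℕ→ℚ (suc N) * iR
  invB = begin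
    invℕ B                                   ≡⟨ ℚP.*-identityˡ (invℕ B) ⟨
    1ℚ * invℕ B                              ≡⟨ cong (_* invℕ B) (invℕ-inverseʳ N) ⟨
    (ℕ→ℚ (suc N) * invℕ (suc N)) * invℕ B   ≡⟨ ℚP.*-assoc (ℕ→ℚ (suc N)) (invℕ (suc N)) (invℕ B) ⟩
    ℕ→ℚ (suc N) * (invℕ (suc N) * invℕ B)   ≡⟨ cong (ℕ→ℚ (suc N) *_) (invℕ-* (suc N) B) ⟨
    ℕ→ℚ (suc N) * iR                         ∎

-- Polynomials over ℚ and the identity theorem

eval-⊕ : ∀ p q x → eval (p ⊕ q) x ≡ eval p x + eval q x
eval-⊕ []      q       x = sym (ℚP.+-identityˡ (eval q x))
eval-⊕ (a ∷ p) []      x = sym (ℚP.+-identityʳ (eval (a ∷ p) x))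
eval-⊕ (a ∷ p) (b ∷ q) x = trans (cong (λ e → (a + b) + x * e) (eval-⊕ p q x))
  (solve 5 (λ a b x u v → (a :+ b) :+ x :* (u :+ v) := (a :+ x :* u) :+ (b :+ x :* v)) refl a b x (eval p x) (eval q x))

eval-scale : ∀ c p x → eval (scale c p) x ≡ c * eval p x
eval-scale c []      x = sym (ℚP.*-zeroʳ c)
eval-scale c (a ∷ p) x = trans (cong (λ e → c * a + x * e) (eval-scale c p x))
  (solve 4 (λ c a x u → c :* a :+ x :* (c :* u) := c :* (a :+ x :* u)) refl c a x (eval p x))

eval-neg : ∀ p x → eval (neg p) x ≡ - eval p x
eval-neg []      x = refl
eval-neg (a ∷ p) x = trans (cong (λ e → - a + x * e) (eval-neg p x))
  (solve 3 (λ a x u → :- a :+ x :* (:- u) := :- (a :+ x :* u)) refl a x (eval p x))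

eval-⊗ : ∀ p q x → eval (p ⊗ q) x ≡ eval p x * eval q x
eval-⊗ []      q x = sym (ℚP.*-zeroˡ (eval q x))
eval-⊗ (a ∷ p) q x = begin
  eval (scale a q ⊕ (0ℚ ∷ (p ⊗ q))) x           ≡⟨ eval-⊕ (scale a q) (0ℚ ∷ (p ⊗ q)) x ⟩
  eval (scale a q) x + (0ℚ + x * eval (p ⊗ q) x) ≡⟨ cong₂ (λ u v → u + (0ℚ + x * v)) (eval-scale a q x) (eval-⊗ p q x) ⟩
  a * eval q x + (0ℚ + x * (eval p x * eval q x))
    ≡⟨ solve 4 (λ a x u v → a :* v :+ (con 0ℚ :+ x :* (u :* v)) := (a :+ x :* u) :* v) refl a x (eval p x) (eval q x) ⟩
  (a + x * eval p x) * eval q x                  ∎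

eval-pow : ∀ one p e x → eval one x ≡ 1ℚ → eval (pow one p e) x ≡ powℚ (eval p x) e
eval-pow one p zero    x one≡1 = one≡1
eval-pow one p (suc e) x one≡1 = trans (eval-⊗ p (pow one p e) x) (cong (eval p x *_) (eval-pow one p e x one≡1))

coeff-⊕ : ∀ r p q → coeff r (p ⊕ q) ≡ coeff r p + coeff r q
coeff-⊕ r       []      q       = sym (ℚP.+-identityˡ _)
coeff-⊕ r       (a ∷ p) []      = sym (ℚP.+-identityʳ _)
coeff-⊕ zero    (a ∷ p) (b ∷ q) = refl
coeff-⊕ (suc r) (a ∷ p) (b ∷ q) = coeff-⊕ r p q

coeff-neg : ∀ r p → coeff r (neg p) ≡ - coeff r p
coeff-neg r       []      = refl
coeff-neg zero    (a ∷ p) = refl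
coeff-neg (suc r) (a ∷ p) = coeff-neg r p

coeff≡0⇒eval≡0 : ∀ p → (∀ r → coeff r p ≡ 0ℚ) → ∀ x → eval p x ≡ 0ℚ
coeff≡0⇒eval≡0 []      p≡0 x = refl
coeff≡0⇒eval≡0 (a ∷ p) p≡0 x =
  trans (cong₂ (λ u v → u + x * v) (p≡0 0) (coeff≡0⇒eval≡0 p (λ r → p≡0 (suc r)) x))
        (solve 1 (λ x → con 0ℚ :+ x :* con 0ℚ := con 0ℚ) refl x)

coeff≡⇒eval≡ : ∀ p q → (∀ r → coeff r p ≡ coeff r q) → ∀ x → eval p x ≡ eval q x
coeff≡⇒eval≡ []      q       p≡q x = sym (coeff≡0⇒eval≡0 q (λ r → sym (p≡q r)) x)
coeff≡⇒eval≡ (a ∷ p) []      p≡q x = coeff≡0⇒eval≡0 (a ∷ p) p≡q x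
coeff≡⇒eval≡ (a ∷ p) (b ∷ q) p≡q x = cong₂ (λ u v → u + x * v) (p≡q 0) (coeff≡⇒eval≡ p q (λ r → p≡q (suc r)) x)

absSum : List ℚ → ℚ
absSum []      = 0ℚ
absSum (a ∷ p) = ∣ a ∣ + absSum p

absSum-nonNeg : ∀ p → 0ℚ ℚ.≤ absSum p
absSum-nonNeg []      = ℚP.≤-refl
absSum-nonNeg (a ∷ p) = ℚP.+-mono-≤ (ℚP.0≤∣p∣ a) (absSum-nonNeg p)

∣eval∣≤absSum : ∀ p t → ∣ t ∣ ℚ.≤ 1ℚ → ∣ eval p t ∣ ℚ.≤ absSum p
∣eval∣≤absSum []      t ∣t∣≤1 = ℚP.≤-refl
∣eval∣≤absSum (a ∷ p) t ∣t∣≤1 =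
  ℚP.≤-trans (ℚP.∣p+q∣≤∣p∣+∣q∣ a (t * eval p t)) (ℚP.+-monoʳ-≤ ∣ a ∣ tail-bound)
  where
  instance
    _ : ℚ.NonNegative ∣ eval p t ∣
    _ = ℚ.nonNegative (ℚP.0≤∣p∣ (eval p t))
  tail-bound : ∣ t * eval p t ∣ ℚ.≤ absSum p
  tail-bound = ℚP.≤-trans (ℚP.≤-reflexive (ℚP.∣p*q∣≡∣p∣*∣q∣ t (eval p t)))
    (ℚP.≤-trans (ℚP.*-monoʳ-≤-nonNeg ∣ eval p t ∣ ∣t∣≤1)
    (ℚP.≤-trans (ℚP.≤-reflexive (ℚP.*-identityˡ ∣ eval p t ∣)) (∣eval∣≤absSum p t ∣t∣≤1)))

-- For 0 < t ≤ 1 the term t · q(t) is at most t · absSum q, so it cannot cancel a nonzero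
-- constant b; the witness is t = ∣b∣ / (∣b∣ + absSum q + 1).
constant-term-zero : ∀ b q → (∀ t → t ≢ 0ℚ → b + t * eval q t ≡ 0ℚ) → b ≡ 0ℚ
constant-term-zero b q vanishes with b ℚ.≟ 0ℚ
... | yes b≡0 = b≡0
... | no  b≢0 = contradiction (ℚP.≤-<-trans β≤tM tM<β) (ℚP.<-irrefl refl)
  where
  β = ∣ b ∣
  M = absSum q
  D = β + (M + 1ℚ)
  0≤β : 0ℚ ℚ.≤ β
  0≤β = ℚP.0≤∣p∣ b
  0≤M+1 : 0ℚ ℚ.≤ M + 1ℚ
  0≤M+1 = ℚP.+-mono-≤ (absSum-nonNeg q) (ℚP.nonNegative⁻¹ 1ℚ)
  instance
    _ : ℚ.Positive β
    _ = ℚP.nonNeg∧nonZero⇒pos β {{ℚ.nonNegative 0≤β}} {{ℚ.≢-nonZero (b≢0 ∘ ℚP.∣p∣≡0⇒p≡0 b)}}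
    _ : ℚ.NonNegative (M + 1ℚ)
    _ = ℚ.nonNegative 0≤M+1
    _ : ℚ.Positive D
    _ = ℚP.pos+nonNeg⇒pos β (M + 1ℚ)
    _ : ℚ.NonZero D
    _ = ℚP.pos⇒nonZero D
    _ : ℚ.Positive (ℚ.1/ D)
    _ = ℚP.1/pos⇒pos D
  t = β * ℚ.1/ D
  instance
    _ : ℚ.Positive t
    _ = ℚP.pos*pos⇒pos β (ℚ.1/ D)
    _ : ℚ.NonNegative t
    _ = ℚP.pos⇒nonNeg t
    _ : ℚ.NonNegative (ℚ.1/ D)
    _ = ℚP.pos⇒nonNeg (ℚ.1/ D)
  t≢0 : t ≢ 0ℚ
  t≢0 t≡0 = ℚP.<-irrefl (sym t≡0) (ℚP.positive⁻¹ t)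
  ∣t∣≤1 : ∣ t ∣ ℚ.≤ 1ℚ
  ∣t∣≤1 = subst₂ ℚ._≤_ (sym (ℚP.0≤p⇒∣p∣≡p (ℚP.nonNegative⁻¹ t))) (ℚP.*-inverseʳ D)
            (ℚP.*-monoʳ-≤-nonNeg (ℚ.1/ D) (subst (ℚ._≤ D) (ℚP.+-identityʳ β) (ℚP.+-monoʳ-≤ β 0≤M+1)))
  β≡t∣q∣ : β ≡ t * ∣ eval q t ∣
  β≡t∣q∣ = begin
    ∣ b ∣                                   ≡⟨ cong ∣_∣ (solve 2 (λ b y → b := (b :+ y) :- y) refl b (t * eval q t)) ⟩
    ∣ (b + t * eval q t) - t * eval q t ∣   ≡⟨ cong (λ e → ∣ e - t * eval q t ∣) (vanishes t t≢0) ⟩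
    ∣ 0ℚ - t * eval q t ∣                   ≡⟨ cong ∣_∣ (ℚP.+-identityˡ (- (t * eval q t))) ⟩
    ∣ - (t * eval q t) ∣                    ≡⟨ ℚP.∣-p∣≡∣p∣ (t * eval q t) ⟩
    ∣ t * eval q t ∣                        ≡⟨ ℚP.∣p*q∣≡∣p∣*∣q∣ t (eval q t) ⟩
    ∣ t ∣ * ∣ eval q t ∣                    ≡⟨ cong (_* ∣ eval q t ∣) (ℚP.0≤p⇒∣p∣≡p (ℚP.nonNegative⁻¹ t)) ⟩
    t * ∣ eval q t ∣                        ∎
  β≤tM : β ℚ.≤ t * M
  β≤tM = subst (ℚ._≤ t * M) (sym β≡t∣q∣) (ℚP.*-monoˡ-≤-nonNeg t (∣eval∣≤absSum q t ∣t∣≤1))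
  M<D : M ℚ.< D
  M<D = ℚP.<-≤-trans (subst (ℚ._< M + 1ℚ) (ℚP.+-identityʳ M) (ℚP.+-monoʳ-< M (ℚP.positive⁻¹ 1ℚ)))
                     (subst (ℚ._≤ D) (ℚP.+-identityˡ (M + 1ℚ)) (ℚP.+-monoˡ-≤ (M + 1ℚ) 0≤β))
  t*D≡β : t * D ≡ β
  t*D≡β = trans (ℚP.*-assoc β (ℚ.1/ D) D) (trans (cong (β *_) (ℚP.*-inverseˡ D)) (ℚP.*-identityʳ β))
  tM<β : t * M ℚ.< β
  tM<β = subst (t * M ℚ.<_) t*D≡β (ℚP.*-monoʳ-<-pos t M<D)

vanishing-off-0⇒coeff≡0 : ∀ p → (∀ t → t ≢ 0ℚ → eval p t ≡ 0ℚ) → ∀ r → coeff r p ≡ 0ℚ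
vanishing-off-0⇒coeff≡0 []      vanishes r       = refl
vanishing-off-0⇒coeff≡0 (b ∷ q) vanishes zero    = constant-term-zero b q vanishes
vanishing-off-0⇒coeff≡0 (b ∷ q) vanishes (suc r) = vanishing-off-0⇒coeff≡0 q q-vanishes r
  where
  q-vanishes : ∀ t → t ≢ 0ℚ → eval q t ≡ 0ℚ
  q-vanishes t t≢0 = begin
    eval q t                           ≡⟨ solve 2 (λ u t⁻¹ → u := (t⁻¹ :* con 0ℚ) :+ u) refl (eval q t) (ℚ.1/ t) ⟩
    ℚ.1/ t * 0ℚ + eval q t             ≡⟨ cong (λ e → ℚ.1/ t * e + eval q t) (sym (constant-term-zero b q vanishes)) ⟩
    ℚ.1/ t * b + eval q t              ≡⟨ cong (ℚ.1/ t * b +_) (sym (ℚP.*-identityˡ (eval q t))) ⟩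
    ℚ.1/ t * b + 1ℚ * eval q t         ≡⟨ cong (λ e → ℚ.1/ t * b + e * eval q t) (sym (ℚP.*-inverseˡ t)) ⟩
    ℚ.1/ t * b + (ℚ.1/ t * t) * eval q t
      ≡⟨ solve 4 (λ i b t u → i :* b :+ (i :* t) :* u := i :* (b :+ t :* u)) refl (ℚ.1/ t) b t (eval q t) ⟩
    ℚ.1/ t * (b + t * eval q t)        ≡⟨ cong (ℚ.1/ t *_) (vanishes t t≢0) ⟩
    ℚ.1/ t * 0ℚ                        ≡⟨ ℚP.*-zeroʳ (ℚ.1/ t) ⟩
    0ℚ                                 ∎
    where
    instance
      _ : ℚ.NonZero t
      _ = ℚ.≢-nonZero t≢0

eval≡⇒coeff≡ : ∀ p q → (∀ t → eval p t ≡ eval q t) → ∀ r → coeff r p ≡ coeff r q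
eval≡⇒coeff≡ p q p≡q r = begin
  coeff r p                                     ≡⟨ solve 2 (λ a b → a := (a :+ :- b) :+ b) refl (coeff r p) (coeff r q) ⟩
  (coeff r p + - coeff r q) + coeff r q         ≡⟨ cong (λ e → (coeff r p + e) + coeff r q) (coeff-neg r q) ⟨
  (coeff r p + coeff r (neg q)) + coeff r q     ≡⟨ cong (_+ coeff r q) (coeff-⊕ r p (neg q)) ⟨
  coeff r (p ⊕ neg q) + coeff r q               ≡⟨ cong (_+ coeff r q) (vanishing-off-0⇒coeff≡0 (p ⊕ neg q) difference-vanishes r) ⟩
  0ℚ + coeff r q                                ≡⟨ ℚP.+-identityˡ (coeff r q) ⟩
  coeff r q                                     ∎
  where
  difference-vanishes : ∀ t → t ≢ 0ℚ → eval (p ⊕ neg q) t ≡ 0ℚ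
  difference-vanishes t _ = begin
    eval (p ⊕ neg q) t          ≡⟨ eval-⊕ p (neg q) t ⟩
    eval p t + eval (neg q) t   ≡⟨ cong₂ _+_ (p≡q t) (eval-neg q t) ⟩
    eval q t - eval q t         ≡⟨ ℚP.+-inverseʳ (eval q t) ⟩
    0ℚ                          ∎

-- Formal derivative, antiderivative and translation

integFromℚ : ℕ → List ℚ → List ℚ
integFromℚ j []      = []
integFromℚ j (c ∷ p) = invℕ (suc j) * c ∷ integFromℚ (suc j) p

antiderivℚ : List ℚ → List ℚ
antiderivℚ f = 0ℚ ∷ integFromℚ 0 f

coeff-integFromℚ : ∀ r j f → coeff r (integFromℚ j f) ≡ invℕ (suc (j ℕ.+ r)) * coeff r f
coeff-integFromℚ r       j []      = sym (ℚP.*-zeroʳ (invℕ (suc (j ℕ.+ r))))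
coeff-integFromℚ zero    j (c ∷ p) = cong (λ e → invℕ (suc e) * c) (sym (ℕP.+-identityʳ j))
coeff-integFromℚ (suc r) j (c ∷ p) =
  trans (coeff-integFromℚ r (suc j) p) (cong (λ e → invℕ (suc e) * coeff r p) (sym (ℕP.+-suc j r)))

deriv : List ℚ → List ℚ
deriv []      = []
deriv (a ∷ p) = p ⊕ (0ℚ ∷ deriv p)

coeff-deriv : ∀ r p → coeff r (deriv p) ≡ ℕ→ℚ (suc r) * coeff (suc r) p
coeff-deriv r       []      = sym (ℚP.*-zeroʳ (ℕ→ℚ (suc r)))
coeff-deriv zero    (a ∷ q) =
  trans (coeff-⊕ 0 q (0ℚ ∷ deriv q)) (trans (ℚP.+-identityʳ (coeff 0 q)) (sym (ℚP.*-identityˡ (coeff 0 q))))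
coeff-deriv (suc r) (a ∷ q) = begin
  coeff (suc r) (q ⊕ (0ℚ ∷ deriv q))                   ≡⟨ coeff-⊕ (suc r) q (0ℚ ∷ deriv q) ⟩
  coeff (suc r) q + coeff r (deriv q)                  ≡⟨ cong (coeff (suc r) q +_) (coeff-deriv r q) ⟩
  coeff (suc r) q + ℕ→ℚ (suc r) * coeff (suc r) q
    ≡⟨ solve 2 (λ c n → c :+ n :* c := (con 1ℚ :+ n) :* c) refl (coeff (suc r) q) (ℕ→ℚ (suc r)) ⟩
  (1ℚ + ℕ→ℚ (suc r)) * coeff (suc r) q                 ≡⟨ cong (_* coeff (suc r) q) (ℕ→ℚ-+ 1 (suc r)) ⟨
  ℕ→ℚ (suc (suc r)) * coeff (suc r) q                  ∎

eval-deriv-antiderivℚ : ∀ f t → eval (deriv (antiderivℚ f)) t ≡ eval f t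
eval-deriv-antiderivℚ f = coeff≡⇒eval≡ (deriv (antiderivℚ f)) f λ r → begin
  coeff r (deriv (antiderivℚ f))                      ≡⟨ coeff-deriv r (antiderivℚ f) ⟩
  ℕ→ℚ (suc r) * coeff r (integFromℚ 0 f)              ≡⟨ cong (ℕ→ℚ (suc r) *_) (coeff-integFromℚ r 0 f) ⟩
  ℕ→ℚ (suc r) * (invℕ (suc r) * coeff r f)            ≡⟨ ℚP.*-assoc (ℕ→ℚ (suc r)) (invℕ (suc r)) (coeff r f) ⟨
  (ℕ→ℚ (suc r) * invℕ (suc r)) * coeff r f            ≡⟨ cong (_* coeff r f) (invℕ-inverseʳ r) ⟩
  1ℚ * coeff r f                                      ≡⟨ ℚP.*-identityˡ (coeff r f) ⟩
  coeff r f                                           ∎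

eval-deriv-∷ : ∀ a p t → eval (deriv (a ∷ p)) t ≡ eval p t + t * eval (deriv p) t
eval-deriv-∷ a p t = trans (eval-⊕ p (0ℚ ∷ deriv p) t) (cong (eval p t +_) (ℚP.+-identityˡ _))

eval-deriv-⊕ : ∀ p q t → eval (deriv (p ⊕ q)) t ≡ eval (deriv p) t + eval (deriv q) t
eval-deriv-⊕ []      q       t = sym (ℚP.+-identityˡ _)
eval-deriv-⊕ (a ∷ p) []      t = sym (ℚP.+-identityʳ _)
eval-deriv-⊕ (a ∷ p) (b ∷ q) t = begin
  eval (deriv ((a + b) ∷ (p ⊕ q))) t                       ≡⟨ eval-deriv-∷ (a + b) (p ⊕ q) t ⟩
  eval (p ⊕ q) t + t * eval (deriv (p ⊕ q)) t              ≡⟨ cong₂ (λ u v → u + t * v) (eval-⊕ p q t) (eval-deriv-⊕ p q t) ⟩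
  (eval p t + eval q t) + t * (eval (deriv p) t + eval (deriv q) t)
    ≡⟨ solve 5 (λ x y t u v → (x :+ y) :+ t :* (u :+ v) := (x :+ t :* u) :+ (y :+ t :* v)) refl
         (eval p t) (eval q t) t (eval (deriv p) t) (eval (deriv q) t) ⟩
  (eval p t + t * eval (deriv p) t) + (eval q t + t * eval (deriv q) t)
    ≡⟨ cong₂ _+_ (eval-deriv-∷ a p t) (eval-deriv-∷ b q t) ⟨
  eval (deriv (a ∷ p)) t + eval (deriv (b ∷ q)) t          ∎

eval-deriv-scale : ∀ c p t → eval (deriv (scale c p)) t ≡ c * eval (deriv p) t
eval-deriv-scale c []      t = sym (ℚP.*-zeroʳ c)
eval-deriv-scale c (a ∷ p) t = begin
  eval (deriv (c * a ∷ scale c p)) t                      ≡⟨ eval-deriv-∷ (c * a) (scale c p) t ⟩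
  eval (scale c p) t + t * eval (deriv (scale c p)) t     ≡⟨ cong₂ (λ u v → u + t * v) (eval-scale c p t) (eval-deriv-scale c p t) ⟩
  c * eval p t + t * (c * eval (deriv p) t)
    ≡⟨ solve 4 (λ c x t y → c :* x :+ t :* (c :* y) := c :* (x :+ t :* y)) refl c (eval p t) t (eval (deriv p) t) ⟩
  c * (eval p t + t * eval (deriv p) t)                   ≡⟨ cong (c *_) (eval-deriv-∷ a p t) ⟨
  c * eval (deriv (a ∷ p)) t                              ∎

eval-deriv-neg : ∀ p t → eval (deriv (neg p)) t ≡ - eval (deriv p) t
eval-deriv-neg []      t = refl
eval-deriv-neg (a ∷ p) t = begin
  eval (deriv (- a ∷ neg p)) t                      ≡⟨ eval-deriv-∷ (- a) (neg p) t ⟩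
  eval (neg p) t + t * eval (deriv (neg p)) t       ≡⟨ cong₂ (λ u v → u + t * v) (eval-neg p t) (eval-deriv-neg p t) ⟩
  - eval p t + t * (- eval (deriv p) t)
    ≡⟨ solve 3 (λ x t y → :- x :+ t :* (:- y) := :- (x :+ t :* y)) refl (eval p t) t (eval (deriv p) t) ⟩
  - (eval p t + t * eval (deriv p) t)               ≡⟨ cong -_ (eval-deriv-∷ a p t) ⟨
  - eval (deriv (a ∷ p)) t                          ∎

eval-deriv-⊗ : ∀ p q t →
  eval (deriv (p ⊗ q)) t ≡ eval (deriv p) t * eval q t + eval p t * eval (deriv q) t
eval-deriv-⊗ []      q t = solve 2 (λ x y → con 0ℚ := con 0ℚ :* x :+ con 0ℚ :* y) refl (eval q t) (eval (deriv q) t)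
eval-deriv-⊗ (a ∷ p) q t = begin
  eval (deriv (scale a q ⊕ (0ℚ ∷ (p ⊗ q)))) t
    ≡⟨ eval-deriv-⊕ (scale a q) (0ℚ ∷ (p ⊗ q)) t ⟩
  eval (deriv (scale a q)) t + eval (deriv (0ℚ ∷ (p ⊗ q))) t
    ≡⟨ cong₂ _+_ (eval-deriv-scale a q t) (eval-deriv-∷ 0ℚ (p ⊗ q) t) ⟩
  a * eval (deriv q) t + (eval (p ⊗ q) t + t * eval (deriv (p ⊗ q)) t)
    ≡⟨ cong₂ (λ u v → a * eval (deriv q) t + (u + t * v)) (eval-⊗ p q t) (eval-deriv-⊗ p q t) ⟩
  a * q′ + (p₀ * q₀ + t * (p′ * q₀ + p₀ * q′))
    ≡⟨ solve 6 (λ a q′ p₀ q₀ t p′ → a :* q′ :+ (p₀ :* q₀ :+ t :* (p′ :* q₀ :+ p₀ :* q′))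
                                  := (p₀ :+ t :* p′) :* q₀ :+ (a :+ t :* p₀) :* q′) refl a q′ p₀ q₀ t p′ ⟩
  (p₀ + t * p′) * q₀ + (a + t * p₀) * q′
    ≡⟨ cong (λ u → u * q₀ + (a + t * p₀) * q′) (eval-deriv-∷ a p t) ⟨
  eval (deriv (a ∷ p)) t * q₀ + eval (a ∷ p) t * q′ ∎
  where
  p₀ = eval p t
  q₀ = eval q t
  p′ = eval (deriv p) t
  q′ = eval (deriv q) t

eval-deriv-const : ∀ a t → eval (deriv (a ∷ [])) t ≡ 0ℚ
eval-deriv-const a t = solve 1 (λ t → con 0ℚ :+ t :* con 0ℚ := con 0ℚ) refl t

X- : ℚ → List ℚ
X- c = - c ∷ 1ℚ ∷ []

eval-X- : ∀ c t → eval (X- c) t ≡ t - c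
eval-X- c t = solve 2 (λ c t → :- c :+ t :* (con 1ℚ :+ t :* con 0ℚ) := t :- c) refl c t

eval-deriv-X- : ∀ c t → eval (deriv (X- c)) t ≡ 1ℚ
eval-deriv-X- c t = trans (eval-deriv-∷ (- c) (1ℚ ∷ []) t)
  (trans (cong (λ e → eval (1ℚ ∷ []) t + t * e) (eval-deriv-const 1ℚ t))
         (solve 1 (λ t → (con 1ℚ :+ t :* con 0ℚ) :+ t :* con 0ℚ := con 1ℚ) refl t))

translate : ℚ → List ℚ → List ℚ
translate c []      = []
translate c (a ∷ h) = (a ∷ []) ⊕ (X- c ⊗ translate c h)

eval-translate : ∀ c h t → eval (translate c h) t ≡ eval h (t - c)
eval-translate c []      t = refl
eval-translate c (a ∷ h) t = begin
  eval ((a ∷ []) ⊕ (X- c ⊗ translate c h)) t              ≡⟨ eval-⊕ (a ∷ []) (X- c ⊗ translate c h) t ⟩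
  eval (a ∷ []) t + eval (X- c ⊗ translate c h) t        ≡⟨ cong (eval (a ∷ []) t +_) (eval-⊗ (X- c) (translate c h) t) ⟩
  eval (a ∷ []) t + eval (X- c) t * eval (translate c h) t
    ≡⟨ cong₂ (λ u v → eval (a ∷ []) t + u * v) (eval-X- c t) (eval-translate c h t) ⟩
  (a + t * 0ℚ) + (t - c) * eval h (t - c)
    ≡⟨ cong (_+ (t - c) * eval h (t - c)) (trans (cong (a +_) (ℚP.*-zeroʳ t)) (ℚP.+-identityʳ a)) ⟩
  a + (t - c) * eval h (t - c)                           ∎

eval-deriv-translate : ∀ c h t → eval (deriv (translate c h)) t ≡ eval (deriv h) (t - c)
eval-deriv-translate c []      t = refl
eval-deriv-translate c (a ∷ h) t = begin
  eval (deriv ((a ∷ []) ⊕ (X- c ⊗ translate c h))) t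
    ≡⟨ eval-deriv-⊕ (a ∷ []) (X- c ⊗ translate c h) t ⟩
  eval (deriv (a ∷ [])) t + eval (deriv (X- c ⊗ translate c h)) t
    ≡⟨ cong₂ _+_ (eval-deriv-const a t) (eval-deriv-⊗ (X- c) (translate c h) t) ⟩
  0ℚ + (eval (deriv (X- c)) t * eval (translate c h) t + eval (X- c) t * eval (deriv (translate c h)) t)
    ≡⟨ cong₂ (λ u v → 0ℚ + (u * eval (translate c h) t + v * eval (deriv (translate c h)) t)) (eval-deriv-X- c t) (eval-X- c t) ⟩
  0ℚ + (1ℚ * eval (translate c h) t + (t - c) * eval (deriv (translate c h)) t)
    ≡⟨ cong₂ (λ u v → 0ℚ + (1ℚ * u + (t - c) * v)) (eval-translate c h t) (eval-deriv-translate c h t) ⟩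
  0ℚ + (1ℚ * eval h (t - c) + (t - c) * eval (deriv h) (t - c))
    ≡⟨ solve 3 (λ x s y → con 0ℚ :+ (con 1ℚ :* x :+ s :* y) := x :+ s :* y) refl (eval h (t - c)) (t - c) (eval (deriv h) (t - c)) ⟩
  eval h (t - c) + (t - c) * eval (deriv h) (t - c)
    ≡⟨ eval-deriv-∷ a h (t - c) ⟨
  eval (deriv (a ∷ h)) (t - c) ∎

deriv≡0⇒const : ∀ g → (∀ t → eval (deriv g) t ≡ 0ℚ) → ∀ t → eval g t ≡ coeff 0 g
deriv≡0⇒const []      g′≡0 t = refl
deriv≡0⇒const (a ∷ g) g′≡0 t =
  trans (cong (λ e → a + t * e) (coeff≡0⇒eval≡0 g higher≡0 t))
        (trans (cong (a +_) (ℚP.*-zeroʳ t)) (ℚP.+-identityʳ a))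
  where
  higher≡0 : ∀ r → coeff r g ≡ 0ℚ
  higher≡0 r = ℕ→ℚ-suc-cancelˡ r (coeff r g)
    (trans (sym (coeff-deriv r (a ∷ g))) (eval≡⇒coeff≡ (deriv (a ∷ g)) [] g′≡0 r))

deriv≡⇒increment≡ : ∀ F G → (∀ t → eval (deriv F) t ≡ eval (deriv G) t) →
  ∀ x y → eval F x - eval F y ≡ eval G x - eval G y
deriv≡⇒increment≡ F G F′≡G′ x y = begin
  eval F x - eval F y                                   ≡⟨ cong₂ _-_ (split x) (split y) ⟩
  (eval g x + eval G x) - (eval g y + eval G y)         ≡⟨ cong₂ (λ u v → (u + eval G x) - (v + eval G y)) (g-const x) (g-const y) ⟩
  (coeff 0 g + eval G x) - (coeff 0 g + eval G y)
    ≡⟨ solve 3 (λ k u v → (k :+ u) :- (k :+ v) := u :- v) refl (coeff 0 g) (eval G x) (eval G y) ⟩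
  eval G x - eval G y                                   ∎
  where
  g = F ⊕ neg G
  split : ∀ x → eval F x ≡ eval g x + eval G x
  split x = begin
    eval F x                               ≡⟨ solve 2 (λ a b → a := (a :- b) :+ b) refl (eval F x) (eval G x) ⟩
    (eval F x - eval G x) + eval G x       ≡⟨ cong (λ e → (eval F x + e) + eval G x) (eval-neg G x) ⟨
    (eval F x + eval (neg G) x) + eval G x ≡⟨ cong (_+ eval G x) (eval-⊕ F (neg G) x) ⟨
    eval g x + eval G x                    ∎
  g-const : ∀ t → eval g t ≡ coeff 0 g
  g-const = deriv≡0⇒const g λ t → begin
    eval (deriv g) t                                ≡⟨ eval-deriv-⊕ F (neg G) t ⟩
    eval (deriv F) t + eval (deriv (neg G)) t       ≡⟨ cong₂ _+_ (F′≡G′ t) (eval-deriv-neg G t) ⟩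
    eval (deriv G) t - eval (deriv G) t             ≡⟨ ℚP.+-inverseʳ (eval (deriv G) t) ⟩
    0ℚ                                              ∎

antiderivℚ-translate : ∀ f h c z → (∀ t → eval f t ≡ eval h (t - c)) →
  eval (antiderivℚ f) (c + z) - eval (antiderivℚ f) c ≡ eval (antiderivℚ h) z
antiderivℚ-translate f h c z f≡h[·-c] = begin
  eval (antiderivℚ f) (c + z) - eval (antiderivℚ f) c
    ≡⟨ deriv≡⇒increment≡ (antiderivℚ f) H F′≡H′ (c + z) c ⟩
  eval H (c + z) - eval H c
    ≡⟨ cong₂ _-_ (eval-translate c (antiderivℚ h) (c + z)) (eval-translate c (antiderivℚ h) c) ⟩
  eval (antiderivℚ h) ((c + z) - c) - eval (antiderivℚ h) (c - c)
    ≡⟨ cong₂ (λ u v → eval (antiderivℚ h) u - eval (antiderivℚ h) v) (solve 2 (λ c z → (c :+ z) :- c := z) refl c z) (ℚP.+-inverseʳ c) ⟩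
  eval (antiderivℚ h) z - eval (antiderivℚ h) 0ℚ
    ≡⟨ solve 2 (λ a b → a :- (con 0ℚ :+ con 0ℚ :* b) := a) refl (eval (antiderivℚ h) z) (eval (integFromℚ 0 h) 0ℚ) ⟩
  eval (antiderivℚ h) z ∎
  where
  H = translate c (antiderivℚ h)
  F′≡H′ : ∀ t → eval (deriv (antiderivℚ f)) t ≡ eval (deriv H) t
  F′≡H′ t = begin
    eval (deriv (antiderivℚ f)) t            ≡⟨ eval-deriv-antiderivℚ f t ⟩
    eval f t                                 ≡⟨ f≡h[·-c] t ⟩
    eval h (t - c)                           ≡⟨ eval-deriv-antiderivℚ h (t - c) ⟨
    eval (deriv (antiderivℚ h)) (t - c)      ≡⟨ eval-deriv-translate c (antiderivℚ h) t ⟨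
    eval (deriv H) t                         ∎

antiderivℚ-⊕ : ∀ p q → antiderivℚ (p ⊕ q) ≡ antiderivℚ p ⊕ antiderivℚ q
antiderivℚ-⊕ p q = cong (0ℚ ∷_) (integFrom-⊕ 0 p q)
  where
  integFrom-⊕ : ∀ j p q → integFromℚ j (p ⊕ q) ≡ integFromℚ j p ⊕ integFromℚ j q
  integFrom-⊕ j []      q       = refl
  integFrom-⊕ j (a ∷ p) []      = refl
  integFrom-⊕ j (a ∷ p) (b ∷ q) = cong₂ _∷_ (ℚP.*-distribˡ-+ (invℕ (suc j)) a b) (integFrom-⊕ (suc j) p q)

eval-antiderivℚ-scale : ∀ c p z → eval (antiderivℚ (scale c p)) z ≡ c * eval (antiderivℚ p) z
eval-antiderivℚ-scale c p z = begin
  0ℚ + z * eval (integFromℚ 0 (scale c p)) z    ≡⟨ cong (λ e → 0ℚ + z * eval e z) (integFrom-scale 0 p) ⟩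
  0ℚ + z * eval (scale c (integFromℚ 0 p)) z    ≡⟨ cong (λ e → 0ℚ + z * e) (eval-scale c (integFromℚ 0 p) z) ⟩
  0ℚ + z * (c * eval (integFromℚ 0 p) z)
    ≡⟨ solve 3 (λ z c u → con 0ℚ :+ z :* (c :* u) := c :* (con 0ℚ :+ z :* u)) refl z c (eval (integFromℚ 0 p) z) ⟩
  c * eval (antiderivℚ p) z                     ∎
  where
  integFrom-scale : ∀ j p → integFromℚ j (scale c p) ≡ scale c (integFromℚ j p)
  integFrom-scale j []      = refl
  integFrom-scale j (a ∷ p) =
    cong₂ _∷_ (solve 3 (λ i c a → i :* (c :* a) := c :* (i :* a)) refl (invℕ (suc j)) c a) (integFrom-scale (suc j) p)

monomial : ℕ → List ℚ
monomial zero    = 1ℚ ∷ []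
monomial (suc n) = 0ℚ ∷ monomial n

eval-monomial : ∀ n s → eval (monomial n) s ≡ powℚ s n
eval-monomial zero    s = solve 1 (λ s → con 1ℚ :+ s :* con 0ℚ := con 1ℚ) refl s
eval-monomial (suc n) s = trans (cong (λ e → 0ℚ + s * e) (eval-monomial n s)) (ℚP.+-identityˡ _)

eval-antiderivℚ-monomial : ∀ n z → eval (antiderivℚ (monomial n)) z ≡ invℕ (suc n) * powℚ z (suc n)
eval-antiderivℚ-monomial n z =
  trans (cong (λ e → 0ℚ + z * e) (eval-integFrom 0 n))
        (solve 3 (λ z i p → con 0ℚ :+ z :* (i :* p) := i :* (z :* p)) refl z (invℕ (suc n)) (powℚ z n))
  where
  eval-integFrom : ∀ j n → eval (integFromℚ j (monomial n)) z ≡ invℕ (suc (j ℕ.+ n)) * powℚ z n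
  eval-integFrom j zero    =
    trans (solve 2 (λ i z → i :* con 1ℚ :+ z :* con 0ℚ := i :* con 1ℚ) refl (invℕ (suc j)) z)
          (cong (λ e → invℕ (suc e) * 1ℚ) (sym (ℕP.+-identityʳ j)))
  eval-integFrom j (suc n) = begin
    invℕ (suc j) * 0ℚ + z * eval (integFromℚ (suc j) (monomial n)) z
      ≡⟨ cong (λ e → invℕ (suc j) * 0ℚ + z * e) (eval-integFrom (suc j) n) ⟩
    invℕ (suc j) * 0ℚ + z * (invℕ (suc (suc j ℕ.+ n)) * powℚ z n)
      ≡⟨ solve 4 (λ a z i p → a :* con 0ℚ :+ z :* (i :* p) := i :* (z :* p)) refl (invℕ (suc j)) z (invℕ (suc (suc j ℕ.+ n))) (powℚ z n) ⟩
    invℕ (suc (suc j ℕ.+ n)) * powℚ z (suc n)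
      ≡⟨ cong (λ e → invℕ (suc e) * powℚ z (suc n)) (sym (ℕP.+-suc j n)) ⟩
    invℕ (suc (j ℕ.+ suc n)) * powℚ z (suc n) ∎

ΣP : ℕ → (ℕ → List ℚ) → List ℚ
ΣP zero    F = []
ΣP (suc n) F = F 0 ⊕ ΣP n (λ i → F (suc i))

eval-ΣP : ∀ n F s → eval (ΣP n F) s ≡ Σ n (λ i → eval (F i) s)
eval-ΣP zero    F s = refl
eval-ΣP (suc n) F s =
  trans (eval-⊕ (F 0) (ΣP n (λ i → F (suc i))) s) (cong (eval (F 0) s +_) (eval-ΣP n (λ i → F (suc i)) s))

eval-antiderivℚ-ΣP : ∀ n F z → eval (antiderivℚ (ΣP n F)) z ≡ Σ n (λ i → eval (antiderivℚ (F i)) z)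
eval-antiderivℚ-ΣP zero    F z = solve 1 (λ z → con 0ℚ :+ z :* con 0ℚ := con 0ℚ) refl z
eval-antiderivℚ-ΣP (suc n) F z = begin
  eval (antiderivℚ (F 0 ⊕ ΣP n (λ i → F (suc i)))) z
    ≡⟨ cong (λ e → eval e z) (antiderivℚ-⊕ (F 0) (ΣP n (λ i → F (suc i)))) ⟩
  eval (antiderivℚ (F 0) ⊕ antiderivℚ (ΣP n (λ i → F (suc i)))) z
    ≡⟨ eval-⊕ (antiderivℚ (F 0)) (antiderivℚ (ΣP n (λ i → F (suc i)))) z ⟩
  eval (antiderivℚ (F 0)) z + eval (antiderivℚ (ΣP n (λ i → F (suc i)))) z
    ≡⟨ cong (eval (antiderivℚ (F 0)) z +_) (eval-antiderivℚ-ΣP n (λ i → F (suc i)) z) ⟩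
  Σ (suc n) (λ i → eval (antiderivℚ (F i)) z) ∎

specialise : ℚ → PT.Poly → List ℚ
specialise z = List.map (λ c → eval c z)

specialise-⊕ : ∀ z p q → specialise z (p PT.⊕ q) ≡ specialise z p ⊕ specialise z q
specialise-⊕ z []      q       = refl
specialise-⊕ z (a ∷ p) []      = refl
specialise-⊕ z (a ∷ p) (b ∷ q) = cong₂ _∷_ (eval-⊕ a b z) (specialise-⊕ z p q)

specialise-scale : ∀ z c q → specialise z (PT.scale c q) ≡ scale (eval c z) (specialise z q)
specialise-scale z c []      = refl
specialise-scale z c (b ∷ q) = cong₂ _∷_ (eval-⊗ c b z) (specialise-scale z c q)

specialise-⊗ : ∀ z p q → specialise z (p PT.⊗ q) ≡ specialise z p ⊗ specialise z q
specialise-⊗ z []      q = refl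
specialise-⊗ z (a ∷ p) q = trans (specialise-⊕ z (PT.scale a q) ([] ∷ (p PT.⊗ q)))
  (cong₂ _⊕_ (specialise-scale z a q) (cong (0ℚ ∷_) (specialise-⊗ z p q)))

specialise-pow : ∀ z one p e → specialise z (PT.pow one p e) ≡ pow (specialise z one) (specialise z p) e
specialise-pow z one p zero    = refl
specialise-pow z one p (suc e) = trans (specialise-⊗ z p (PT.pow one p e)) (cong (specialise z p ⊗_) (specialise-pow z one p e))

specialise-integFrom : ∀ z j p → specialise z (integFrom j p) ≡ integFromℚ j (specialise z p)
specialise-integFrom z j []      = refl
specialise-integFrom z j (c ∷ p) = cong₂ _∷_ (eval-scale (invℕ (suc j)) c z) (specialise-integFrom z (suc j) p)

eval-PT-eval : ∀ z F c → eval (PT.eval F c) z ≡ eval (specialise z F) (eval c z)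
eval-PT-eval z []      c = refl
eval-PT-eval z (a ∷ F) c = trans (eval-⊕ a (c ⊗ PT.eval F c) z)
  (cong (eval a z +_) (trans (eval-⊗ c (PT.eval F c) z) (cong (eval c z *_) (eval-PT-eval z F c))))

eval-constZ : ∀ a z → eval (constZ a) z ≡ a
eval-constZ a z = solve 2 (λ a z → a :+ z :* con 0ℚ := a) refl a z

eval-x2Z : ∀ x1 z → eval (x2Z x1) z ≡ x1 + z
eval-x2Z x1 z = solve 2 (λ x z → x :+ z :* (con 1ℚ :+ z :* con 0ℚ) := x :+ z) refl x1 z

eval-Q : ∀ k m x1 {l} (xs : Vec ℚ l) z → let f = specialise z (integrand k m x1 xs) in
  eval (Q k m x1 xs) z ≡ eval (antiderivℚ f) (x1 + z) - eval (antiderivℚ f) x1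
eval-Q k m x1 xs z = begin
  eval (PT.eval F (x2Z x1) ⊕ neg (PT.eval F (constZ x1))) z
    ≡⟨ eval-⊕ (PT.eval F (x2Z x1)) (neg (PT.eval F (constZ x1))) z ⟩
  eval (PT.eval F (x2Z x1)) z + eval (neg (PT.eval F (constZ x1))) z
    ≡⟨ cong (eval (PT.eval F (x2Z x1)) z +_) (eval-neg (PT.eval F (constZ x1)) z) ⟩
  eval (PT.eval F (x2Z x1)) z - eval (PT.eval F (constZ x1)) z
    ≡⟨ cong₂ _-_ (eval-PT-eval z F (x2Z x1)) (eval-PT-eval z F (constZ x1)) ⟩
  eval (specialise z F) (eval (x2Z x1) z) - eval (specialise z F) (eval (constZ x1) z)
    ≡⟨ cong₂ (λ u v → eval (specialise z F) u - eval (specialise z F) v) (eval-x2Z x1 z) (eval-constZ x1 z) ⟩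
  eval (specialise z F) (x1 + z) - eval (specialise z F) x1
    ≡⟨ cong (λ G → eval G (x1 + z) - eval G x1) (cong (0ℚ ∷_) (specialise-integFrom z 0 (integrand k m x1 xs))) ⟩
  eval (antiderivℚ f) (x1 + z) - eval (antiderivℚ f) x1 ∎
  where
  F = antideriv (integrand k m x1 xs)
  f = specialise z (integrand k m x1 xs)

eval₂ : PT.Poly → ℚ → ℚ → ℚ
eval₂ F z t = eval (specialise z F) t

eval₂-⊗ : ∀ p q z t → eval₂ (p PT.⊗ q) z t ≡ eval₂ p z t * eval₂ q z t
eval₂-⊗ p q z t = trans (cong (λ e → eval e t) (specialise-⊗ z p q)) (eval-⊗ (specialise z p) (specialise z q) t)

eval₂-oneT : ∀ z t → eval₂ oneT z t ≡ 1ℚ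
eval₂-oneT z t = solve 2 (λ z t → (con 1ℚ :+ z :* con 0ℚ) :+ t :* con 0ℚ := con 1ℚ) refl z t

eval₂-pow : ∀ p e z t → eval₂ (PT.pow oneT p e) z t ≡ powℚ (eval₂ p z t) e
eval₂-pow p e z t = trans (cong (λ e → eval e t) (specialise-pow z oneT p e))
  (eval-pow (specialise z oneT) (specialise z p) e t (eval₂-oneT z t))

eval₂-tT : ∀ z t → eval₂ tT z t ≡ t
eval₂-tT z t = solve 2 (λ z t → con 0ℚ :+ t :* ((con 1ℚ :+ z :* con 0ℚ) :+ t :* con 0ℚ) := t) refl z t

eval₂-t-minus : ∀ c z t → eval₂ (t-minus c) z t ≡ t - eval c z
eval₂-t-minus c z t = trans (cong (λ e → e + t * ((1ℚ + z * 0ℚ) + t * 0ℚ)) (eval-neg c z))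
  (solve 3 (λ e z t → :- e :+ t :* ((con 1ℚ :+ z :* con 0ℚ) :+ t :* con 0ℚ) := t :- e) refl (eval c z) z t)

∏factors : ∀ {l} → ℕ → Vec ℚ l → ℚ → ℚ
∏factors m []       t = 1ℚ
∏factors m (x ∷ xs) t = powℚ (t - x) m * ∏factors m xs t

eval₂-prodFactors : ∀ m {l} (xs : Vec ℚ l) z t → eval₂ (prodFactors m xs) z t ≡ ∏factors m xs t
eval₂-prodFactors m []       z t = eval₂-oneT z t
eval₂-prodFactors m (x ∷ xs) z t = begin
  eval₂ (PT.pow oneT (t-minus (constZ x)) m PT.⊗ prodFactors m xs) z t
    ≡⟨ eval₂-⊗ (PT.pow oneT (t-minus (constZ x)) m) (prodFactors m xs) z t ⟩
  eval₂ (PT.pow oneT (t-minus (constZ x)) m) z t * eval₂ (prodFactors m xs) z t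
    ≡⟨ cong₂ _*_ (eval₂-pow (t-minus (constZ x)) m z t) (eval₂-prodFactors m xs z t) ⟩
  powℚ (eval₂ (t-minus (constZ x)) z t) m * ∏factors m xs t
    ≡⟨ cong (λ e → powℚ e m * ∏factors m xs t) (trans (eval₂-t-minus (constZ x) z t) (cong (λ e → t - e) (eval-constZ x z))) ⟩
  powℚ (t - x) m * ∏factors m xs t ∎

eval₂-integrand : ∀ k m x1 {l} (xs : Vec ℚ l) z t →
  eval₂ (integrand k m x1 xs) z t ≡ powℚ t k * (powℚ (t - x1) m * (powℚ (t - (x1 + z)) m * ∏factors m xs t))
eval₂-integrand k m x1 xs z t = begin
  eval₂ (T^k PT.⊗ (L₁ PT.⊗ (L₂ PT.⊗ Π))) z t                          ≡⟨ eval₂-⊗ T^k (L₁ PT.⊗ (L₂ PT.⊗ Π)) z t ⟩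
  eval₂ T^k z t * eval₂ (L₁ PT.⊗ (L₂ PT.⊗ Π)) z t                      ≡⟨ cong (eval₂ T^k z t *_) (eval₂-⊗ L₁ (L₂ PT.⊗ Π) z t) ⟩
  eval₂ T^k z t * (eval₂ L₁ z t * eval₂ (L₂ PT.⊗ Π) z t)               ≡⟨ cong (λ e → eval₂ T^k z t * (eval₂ L₁ z t * e)) (eval₂-⊗ L₂ Π z t) ⟩
  eval₂ T^k z t * (eval₂ L₁ z t * (eval₂ L₂ z t * eval₂ Π z t))
    ≡⟨ cong₂ _*_ T^k≡ (cong₂ _*_ L₁≡ (cong₂ _*_ L₂≡ (eval₂-prodFactors m xs z t))) ⟩
  powℚ t k * (powℚ (t - x1) m * (powℚ (t - (x1 + z)) m * ∏factors m xs t)) ∎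
  where
  T^k = PT.pow oneT tT k
  L₁ = PT.pow oneT (t-minus (constZ x1)) m
  L₂ = PT.pow oneT (t-minus (x2Z x1)) m
  Π = prodFactors m xs
  T^k≡ : eval₂ T^k z t ≡ powℚ t k
  T^k≡ = trans (eval₂-pow tT k z t) (cong (λ e → powℚ e k) (eval₂-tT z t))
  L₁≡ : eval₂ L₁ z t ≡ powℚ (t - x1) m
  L₁≡ = trans (eval₂-pow (t-minus (constZ x1)) m z t)
    (cong (λ e → powℚ e m) (trans (eval₂-t-minus (constZ x1) z t) (cong (λ e → t - e) (eval-constZ x1 z))))
  L₂≡ : eval₂ L₂ z t ≡ powℚ (t - (x1 + z)) m
  L₂≡ = trans (eval₂-pow (t-minus (x2Z x1)) m z t)
    (cong (λ e → powℚ e m) (trans (eval₂-t-minus (x2Z x1) z t) (cong (λ e → t - e) (eval-x2Z x1 z))))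

-- Expansion of the integrand after the substitution t = x₁ + s

∸-+-∸ : ∀ {m i N S} → i ≤ m → S ≤ N → (m ℕ.∸ i) ℕ.+ (N ℕ.∸ S) ≡ (m ℕ.+ N) ℕ.∸ (i ℕ.+ S)
∸-+-∸ {m} {i} {N} {S} i≤m S≤N = begin
  (m ℕ.∸ i) ℕ.+ (N ℕ.∸ S)        ≡⟨ ℕP.+-∸-assoc (m ℕ.∸ i) S≤N ⟨
  ((m ℕ.∸ i) ℕ.+ N) ℕ.∸ S        ≡⟨ cong (ℕ._∸ S) (ℕP.+-∸-comm N i≤m) ⟨
  ((m ℕ.+ N) ℕ.∸ i) ℕ.∸ S        ≡⟨ ℕP.∸-+-assoc (m ℕ.+ N) i S ⟩
  (m ℕ.+ N) ℕ.∸ (i ℕ.+ S)        ∎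

All≤⇒sum≤ : ∀ {l} m (is : Vec ℕ l) → All (ℕ._≤ m) is → Vec.sum is ≤ m ℕ.* l
All≤⇒sum≤ m [] [] = z≤n
All≤⇒sum≤ {suc l} m (i ∷ is) (i≤m ∷ is≤m) =
  subst (Vec.sum (i ∷ is) ≤_) (sym (ℕP.*-suc m l)) (ℕP.+-mono-≤ i≤m (All≤⇒sum≤ m is is≤m))

-- the paper's K = k + m(n - 2) - (i₃ + ⋯ + iₙ): the exponent of t in the term of
-- t^k ∏_{j≥3} (t - x_j)^m selected by is = (i₃,…,iₙ)
degK : ℕ → ℕ → (l : ℕ) → Vec ℕ l → ℕ
degK k m l is = (k ℕ.+ m ℕ.* l) ℕ.∸ Vec.sum is

degK-∷ : ∀ k m l i (is : Vec ℕ l) → i ≤ m → Vec.sum is ≤ m ℕ.* l →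
  (m ℕ.∸ i) ℕ.+ degK k m l is ≡ degK k m (suc l) (i ∷ is)
degK-∷ k m l i is i≤m S≤ = trans (∸-+-∸ i≤m (ℕP.≤-trans S≤ (ℕP.m≤n+m (m ℕ.* l) k)))
  (cong (ℕ._∸ (i ℕ.+ Vec.sum is)) (rearrange k m l))
  where
  rearrange : ∀ k m l → m ℕ.+ (k ℕ.+ m ℕ.* l) ≡ k ℕ.+ m ℕ.* suc l
  rearrange = solve-∀

weight : ∀ {l} → ℕ → Vec ℚ l → Vec ℕ l → ℚ
weight m xs is =
  sign (Vec.sum is) * (ℕ→ℚ (Vec.foldr _ ℕ._*_ 1 (Vec.map (m C_) is)) * Vec.foldr _ _*_ 1ℚ (Vec.zipWith powℚ xs is))

∏factors-expansion : ∀ k m {l} (xs : Vec ℚ l) u →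
  powℚ u k * ∏factors m xs u ≡ sumTuples l m (λ is → weight m xs is * powℚ u (degK k m l is))
∏factors-expansion k m [] u = begin
  powℚ u k * 1ℚ                             ≡⟨ ℚP.*-identityʳ (powℚ u k) ⟩
  powℚ u k                                  ≡⟨ cong (powℚ u) (trans (cong (k ℕ.+_) (ℕP.*-zeroʳ m)) (ℕP.+-identityʳ k)) ⟨
  powℚ u (k ℕ.+ m ℕ.* 0)                    ≡⟨ ℚP.*-identityˡ _ ⟨
  1ℚ * powℚ u (k ℕ.+ m ℕ.* 0)               ≡⟨⟩
  weight m [] [] * powℚ u (degK k m 0 [])   ∎
∏factors-expansion k m {suc l} (x ∷ xs) u = begin
  powℚ u k * (powℚ (u - x) m * ∏factors m xs u)
    ≡⟨ solve 3 (λ a b c → a :* (b :* c) := b :* (a :* c)) refl (powℚ u k) (powℚ (u - x) m) (∏factors m xs u) ⟩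
  powℚ (u - x) m * (powℚ u k * ∏factors m xs u)
    ≡⟨ cong₂ _*_ (binomial-theorem m u (- x)) (∏factors-expansion k m xs u) ⟩
  Σ (suc m) T * rest
    ≡⟨ *-distribʳ-Σ (suc m) rest T ⟩
  Σ (suc m) (λ i → T i * rest)
    ≡⟨ Σ-cong (suc m) (λ i → *-distribˡ-sumTuples l m (T i) (λ is → weight m xs is * powℚ u (degK k m l is))) ⟩
  Σ (suc m) (λ i → sumTuples l m (λ is → T i * (weight m xs is * powℚ u (degK k m l is))))
    ≡⟨ Σ-cong< (suc m) (λ i i<1+m → sumTuples-cong≤ l m (λ is is≤m → term i is (ℕP.≤-pred i<1+m) (All≤⇒sum≤ m is is≤m))) ⟩
  Σ (suc m) (λ i → sumTuples l m (λ is → weight m (x ∷ xs) (i ∷ is) * powℚ u (degK k m (suc l) (i ∷ is))))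
    ≡⟨ sumTuples-suc l m (λ is → weight m (x ∷ xs) is * powℚ u (degK k m (suc l) is)) ⟨
  sumTuples (suc l) m (λ is → weight m (x ∷ xs) is * powℚ u (degK k m (suc l) is)) ∎
  where
  T = λ i → binomℚ m i * (powℚ u (m ℕ.∸ i) * powℚ (- x) i)
  rest = sumTuples l m (λ is → weight m xs is * powℚ u (degK k m l is))
  term : ∀ i is → i ≤ m → Vec.sum is ≤ m ℕ.* l →
    T i * (weight m xs is * powℚ u (degK k m l is)) ≡ weight m (x ∷ xs) (i ∷ is) * powℚ u (degK k m (suc l) (i ∷ is))
  term i is i≤m S≤ = begin
    T i * ((sign S * (∏C * ∏x)) * uᴷ)
      ≡⟨ cong (λ e → binomℚ m i * (uᵐ⁻ⁱ * e) * ((sign S * (∏C * ∏x)) * uᴷ)) (powℚ-neg x i) ⟩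
    binomℚ m i * (uᵐ⁻ⁱ * (sign i * xⁱ)) * ((sign S * (∏C * ∏x)) * uᴷ)
      ≡⟨ solve 8 (λ c u si xi sS pc px uk → c :* (u :* (si :* xi)) :* ((sS :* (pc :* px)) :* uk)
                                         := (si :* sS) :* ((c :* pc) :* (xi :* px)) :* (u :* uk))
               refl (binomℚ m i) uᵐ⁻ⁱ (sign i) xⁱ (sign S) ∏C ∏x uᴷ ⟩
    (sign i * sign S) * ((binomℚ m i * ∏C) * (xⁱ * ∏x)) * (uᵐ⁻ⁱ * uᴷ)
      ≡⟨ cong₂ (λ a b → a * (b * (xⁱ * ∏x)) * (uᵐ⁻ⁱ * uᴷ)) (sign-+ i S) (ℕ→ℚ-* (m C i) ∏Cₙ) ⟨
    sign (i ℕ.+ S) * (ℕ→ℚ ((m C i) ℕ.* ∏Cₙ) * (xⁱ * ∏x)) * (uᵐ⁻ⁱ * uᴷ)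
      ≡⟨ cong (sign (i ℕ.+ S) * (ℕ→ℚ ((m C i) ℕ.* ∏Cₙ) * (xⁱ * ∏x)) *_)
              (trans (sym (powℚ-+ u (m ℕ.∸ i) (degK k m l is))) (cong (powℚ u) (degK-∷ k m l i is i≤m S≤))) ⟩
    weight m (x ∷ xs) (i ∷ is) * powℚ u (degK k m (suc l) (i ∷ is)) ∎
    where
    S = Vec.sum is
    ∏Cₙ = Vec.foldr _ ℕ._*_ 1 (Vec.map (m C_) is)
    ∏C = ℕ→ℚ ∏Cₙ
    ∏x = Vec.foldr _ _*_ 1ℚ (Vec.zipWith powℚ xs is)
    xⁱ = powℚ x i
    uᵐ⁻ⁱ = powℚ u (m ℕ.∸ i)
    uᴷ = powℚ u (degK k m l is)

-- coefficient of s^p in (x₁ + s)^k ∏_{j≥3} (x₁ + s - x_j)^m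
shiftedCoeff : ∀ {l} → ℕ → ℕ → ℚ → Vec ℚ l → ℕ → ℚ
shiftedCoeff {l} k m x1 xs p =
  sumTuples l m (λ is → weight m xs is * (binomℚ (degK k m l is) p * powℚ x1 (degK k m l is ℕ.∸ p)))

∏factors-expansion-at-x1+ : ∀ k m x1 {l} (xs : Vec ℚ l) s →
  powℚ (x1 + s) k * ∏factors m xs (x1 + s) ≡ Σ (suc (k ℕ.+ m ℕ.* l)) (λ p → powℚ s p * shiftedCoeff k m x1 xs p)
∏factors-expansion-at-x1+ k m x1 {l} xs s = begin
  powℚ (x1 + s) k * ∏factors m xs (x1 + s)
    ≡⟨ ∏factors-expansion k m xs (x1 + s) ⟩
  sumTuples l m (λ is → weight m xs is * powℚ (x1 + s) (K is))
    ≡⟨ sumTuples-cong l m (λ is → cong (weight m xs is *_) (binomial-theorem-≤ (K is) N x1 s (ℕP.m∸n≤m N (Vec.sum is)))) ⟩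
  sumTuples l m (λ is → weight m xs is * Σ (suc N) (λ p → binomℚ (K is) p * (powℚ x1 (K is ℕ.∸ p) * powℚ s p)))
    ≡⟨ sumTuples-cong l m (λ is → *-distribˡ-Σ (suc N) (weight m xs is) (term is)) ⟩
  sumTuples l m (λ is → Σ (suc N) (λ p → weight m xs is * (binomℚ (K is) p * (powℚ x1 (K is ℕ.∸ p) * powℚ s p))))
    ≡⟨ sumTuples-Σ-comm l m (suc N) (λ is p → weight m xs is * (binomℚ (K is) p * (powℚ x1 (K is ℕ.∸ p) * powℚ s p))) ⟩
  Σ (suc N) (λ p → sumTuples l m (λ is → weight m xs is * (binomℚ (K is) p * (powℚ x1 (K is ℕ.∸ p) * powℚ s p))))
    ≡⟨ Σ-cong (suc N) (λ p → trans (sumTuples-cong l m (λ is → pull-out is p))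
                                   (sym (*-distribˡ-sumTuples l m (powℚ s p) (λ is → shifted is p)))) ⟩
  Σ (suc N) (λ p → powℚ s p * shiftedCoeff k m x1 xs p) ∎
  where
  N = k ℕ.+ m ℕ.* l
  K = degK k m l
  term = λ is p → binomℚ (K is) p * (powℚ x1 (K is ℕ.∸ p) * powℚ s p)
  shifted = λ is p → weight m xs is * (binomℚ (K is) p * powℚ x1 (K is ℕ.∸ p))
  pull-out : ∀ is p → weight m xs is * (binomℚ (K is) p * (powℚ x1 (K is ℕ.∸ p) * powℚ s p))
                    ≡ powℚ s p * (weight m xs is * (binomℚ (K is) p * powℚ x1 (K is ℕ.∸ p)))
  pull-out is p = solve 4 (λ w c a b → w :* (c :* (a :* b)) := b :* (w :* (c :* a))) refl
                          (weight m xs is) (binomℚ (K is) p) (powℚ x1 (K is ℕ.∸ p)) (powℚ s p)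

shiftedIntegrandCoeff : ∀ {l} → ℕ → ℕ → ℚ → Vec ℚ l → ℚ → ℕ → ℕ → ℚ
shiftedIntegrandCoeff k m x1 xs z p a = (binomℚ m a * powℚ (- z) (m ℕ.∸ a)) * shiftedCoeff k m x1 xs p

-- s ↦ s^m (s - z)^m (x₁ + s)^k ∏_{j≥3} (x₁ + s - x_j)^m, expanded in powers of s
shiftedIntegrand : ∀ {l} → ℕ → ℕ → ℚ → Vec ℚ l → ℚ → List ℚ
shiftedIntegrand {l} k m x1 xs z = ΣP (suc (k ℕ.+ m ℕ.* l)) λ p → ΣP (suc m) λ a →
  scale (shiftedIntegrandCoeff k m x1 xs z p a) (monomial (m ℕ.+ a ℕ.+ p))

eval-shiftedIntegrand : ∀ k m x1 {l} (xs : Vec ℚ l) z s →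
  eval (shiftedIntegrand k m x1 xs z) s
    ≡ Σ (suc (k ℕ.+ m ℕ.* l)) (λ p → Σ (suc m) (λ a → shiftedIntegrandCoeff k m x1 xs z p a * powℚ s (m ℕ.+ a ℕ.+ p)))
eval-shiftedIntegrand k m x1 {l} xs z s =
  trans (eval-ΣP (suc (k ℕ.+ m ℕ.* l)) (λ p → ΣP (suc m) (term p)) s) (Σ-cong (suc (k ℕ.+ m ℕ.* l)) λ p →
  trans (eval-ΣP (suc m) (term p) s) (Σ-cong (suc m) λ a →
  trans (eval-scale (c p a) (monomial (m ℕ.+ a ℕ.+ p)) s) (cong (c p a *_) (eval-monomial (m ℕ.+ a ℕ.+ p) s))))
  where
  c = shiftedIntegrandCoeff k m x1 xs z
  term = λ p a → scale (c p a) (monomial (m ℕ.+ a ℕ.+ p))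

eval-antiderivℚ-shiftedIntegrand : ∀ k m x1 {l} (xs : Vec ℚ l) z →
  eval (antiderivℚ (shiftedIntegrand k m x1 xs z)) z
    ≡ Σ (suc (k ℕ.+ m ℕ.* l)) (λ p → Σ (suc m) (λ a →
        shiftedIntegrandCoeff k m x1 xs z p a * (invℕ (suc (m ℕ.+ a ℕ.+ p)) * powℚ z (suc (m ℕ.+ a ℕ.+ p)))))
eval-antiderivℚ-shiftedIntegrand k m x1 {l} xs z =
  trans (eval-antiderivℚ-ΣP (suc (k ℕ.+ m ℕ.* l)) (λ p → ΣP (suc m) (term p)) z) (Σ-cong (suc (k ℕ.+ m ℕ.* l)) λ p →
  trans (eval-antiderivℚ-ΣP (suc m) (term p) z) (Σ-cong (suc m) λ a →
  trans (eval-antiderivℚ-scale (c p a) (monomial (m ℕ.+ a ℕ.+ p)) z)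
        (cong (c p a *_) (eval-antiderivℚ-monomial (m ℕ.+ a ℕ.+ p) z))))
  where
  c = shiftedIntegrandCoeff k m x1 xs z
  term = λ p a → scale (c p a) (monomial (m ℕ.+ a ℕ.+ p))

integrand≡shiftedIntegrand : ∀ k m x1 {l} (xs : Vec ℚ l) z t →
  eval₂ (integrand k m x1 xs) z t ≡ eval (shiftedIntegrand k m x1 xs z) (t - x1)
integrand≡shiftedIntegrand k m x1 {l} xs z t = begin
  eval₂ (integrand k m x1 xs) z t
    ≡⟨ eval₂-integrand k m x1 xs z t ⟩
  powℚ t k * (powℚ s m * (powℚ (t - (x1 + z)) m * ∏factors m xs t))
    ≡⟨ cong₂ (λ u v → powℚ u k * (powℚ s m * (powℚ v m * ∏factors m xs u)))
             (solve 2 (λ t x → t := x :+ (t :- x)) refl t x1) (solve 3 (λ t x z → t :- (x :+ z) := :- z :+ (t :- x)) refl t x1 z) ⟩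
  powℚ (x1 + s) k * (powℚ s m * (powℚ (- z + s) m * ∏factors m xs (x1 + s)))
    ≡⟨ solve 4 (λ a b c d → a :* (b :* (c :* d)) := b :* (c :* (a :* d))) refl
               (powℚ (x1 + s) k) (powℚ s m) (powℚ (- z + s) m) (∏factors m xs (x1 + s)) ⟩
  powℚ s m * (powℚ (- z + s) m * (powℚ (x1 + s) k * ∏factors m xs (x1 + s)))
    ≡⟨ cong₂ (λ u v → powℚ s m * (u * v)) (binomial-theorem m (- z) s) (∏factors-expansion-at-x1+ k m x1 xs s) ⟩
  powℚ s m * (Σ (suc m) B * Σ (suc N) G)
    ≡⟨ solve 3 (λ a b g → a :* (b :* g) := g :* (a :* b)) refl (powℚ s m) (Σ (suc m) B) (Σ (suc N) G) ⟩
  Σ (suc N) G * (powℚ s m * Σ (suc m) B)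
    ≡⟨ *-distribʳ-Σ (suc N) (powℚ s m * Σ (suc m) B) G ⟩
  Σ (suc N) (λ p → G p * (powℚ s m * Σ (suc m) B))
    ≡⟨ Σ-cong (suc N) (λ p → trans (sym (ℚP.*-assoc (G p) (powℚ s m) (Σ (suc m) B)))
                                   (trans (*-distribˡ-Σ (suc m) (G p * powℚ s m) B) (Σ-cong (suc m) (term p)))) ⟩
  Σ (suc N) (λ p → Σ (suc m) (λ a → shiftedIntegrandCoeff k m x1 xs z p a * powℚ s (m ℕ.+ a ℕ.+ p)))
    ≡⟨ eval-shiftedIntegrand k m x1 xs z s ⟨
  eval (shiftedIntegrand k m x1 xs z) s ∎
  where
  s = t - x1
  N = k ℕ.+ m ℕ.* l
  B = λ a → binomℚ m a * (powℚ (- z) (m ℕ.∸ a) * powℚ s a)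
  G = λ p → powℚ s p * shiftedCoeff k m x1 xs p
  term : ∀ p a → G p * powℚ s m * B a ≡ shiftedIntegrandCoeff k m x1 xs z p a * powℚ s (m ℕ.+ a ℕ.+ p)
  term p a = begin
    (powℚ s p * c) * powℚ s m * (binomℚ m a * (zᵐ⁻ᵃ * powℚ s a))
      ≡⟨ solve 6 (λ sp c sm C Z sa → (sp :* c) :* sm :* (C :* (Z :* sa)) := ((C :* Z) :* c) :* ((sm :* sa) :* sp))
                 refl (powℚ s p) c (powℚ s m) (binomℚ m a) zᵐ⁻ᵃ (powℚ s a) ⟩
    ((binomℚ m a * zᵐ⁻ᵃ) * c) * ((powℚ s m * powℚ s a) * powℚ s p)
      ≡⟨ cong (λ e → ((binomℚ m a * zᵐ⁻ᵃ) * c) * (e * powℚ s p)) (sym (powℚ-+ s m a)) ⟩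
    ((binomℚ m a * zᵐ⁻ᵃ) * c) * (powℚ s (m ℕ.+ a) * powℚ s p)
      ≡⟨ cong (((binomℚ m a * zᵐ⁻ᵃ) * c) *_) (sym (powℚ-+ s (m ℕ.+ a) p)) ⟩
    shiftedIntegrandCoeff k m x1 xs z p a * powℚ s (m ℕ.+ a ℕ.+ p) ∎
    where
    c = shiftedCoeff k m x1 xs p
    zᵐ⁻ᵃ = powℚ (- z) (m ℕ.∸ a)

eval-Q≡∫shiftedIntegrand : ∀ k m x1 {l} (xs : Vec ℚ l) z →
  eval (Q k m x1 xs) z ≡ eval (antiderivℚ (shiftedIntegrand k m x1 xs z)) z
eval-Q≡∫shiftedIntegrand k m x1 xs z =
  trans (eval-Q k m x1 xs z)
        (antiderivℚ-translate (specialise z (integrand k m x1 xs)) (shiftedIntegrand k m x1 xs z) x1 z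
                              (integrand≡shiftedIntegrand k m x1 xs z))

binomShift-< : ∀ a r m → r ℕ.< suc (2 ℕ.* m) → binomShift a r m ≡ 0
binomShift-< a r m r<2m+1 with r ℕ.<? suc (2 ℕ.* m)
... | yes _     = refl
... | no  r≮2m+1 = contradiction r<2m+1 r≮2m+1

binomShift-+ : ∀ a m p → binomShift a (suc (2 ℕ.* m) ℕ.+ p) m ≡ a C p
binomShift-+ a m p with suc (2 ℕ.* m) ℕ.+ p ℕ.<? suc (2 ℕ.* m)
... | yes r<2m+1 = contradiction r<2m+1 (ℕP.m+n≮m (suc (2 ℕ.* m)) p)
... | no  _      = cong (a C_) (ℕP.m+n∸m≡n (suc (2 ℕ.* m)) p)

summand-shifted : ∀ k m x1 {l} (xs : Vec ℚ l) p is →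
  summand k m (suc (2 ℕ.* m) ℕ.+ p) x1 xs is
    ≡ sign m * (weight m xs is * (binomℚ (degK k m l is) p * powℚ x1 (degK k m l is ℕ.∸ p)))
summand-shifted k m x1 {l} xs p is = begin
  sign (m ℕ.+ S) * (∏C * (ℕ→ℚ (binomShift K r m) * (powℚ x1 (K ℕ.∸ (r ℕ.∸ suc (2 ℕ.* m))) * ∏x)))
    ≡⟨ cong₂ (λ u v → sign (m ℕ.+ S) * (∏C * (ℕ→ℚ u * (powℚ x1 (K ℕ.∸ v) * ∏x))))
             (binomShift-+ K m p) (ℕP.m+n∸m≡n (suc (2 ℕ.* m)) p) ⟩
  sign (m ℕ.+ S) * (∏C * (binomℚ K p * (powℚ x1 (K ℕ.∸ p) * ∏x)))
    ≡⟨ cong (_* (∏C * (binomℚ K p * (powℚ x1 (K ℕ.∸ p) * ∏x)))) (sign-+ m S) ⟩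
  (sign m * sign S) * (∏C * (binomℚ K p * (powℚ x1 (K ℕ.∸ p) * ∏x)))
    ≡⟨ solve 6 (λ sm sS c b x px → (sm :* sS) :* (c :* (b :* (x :* px))) := sm :* ((sS :* (c :* px)) :* (b :* x)))
               refl (sign m) (sign S) ∏C (binomℚ K p) (powℚ x1 (K ℕ.∸ p)) ∏x ⟩
  sign m * (weight m xs is * (binomℚ K p * powℚ x1 (K ℕ.∸ p))) ∎
  where
  r = suc (2 ℕ.* m) ℕ.+ p
  S = Vec.sum is
  K = degK k m l is
  ∏C = ℕ→ℚ (Vec.foldr _ ℕ._*_ 1 (Vec.map (m C_) is))
  ∏x = Vec.foldr _ _*_ 1ℚ (Vec.zipWith powℚ xs is)

-- the z^(2m+1+p) part of ∫₀^z h; the sum over the binomial index of (s - z)^m is a Beta sum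
integrated-terms≡rhs : ∀ k m x1 {l} (xs : Vec ℚ l) z p →
  Σ (suc m) (λ a → shiftedIntegrandCoeff k m x1 xs z p a * (invℕ (suc (m ℕ.+ a ℕ.+ p)) * powℚ z (suc (m ℕ.+ a ℕ.+ p))))
    ≡ rhs k m (suc (2 ℕ.* m) ℕ.+ p) x1 xs * powℚ z (suc (2 ℕ.* m) ℕ.+ p)
integrated-terms≡rhs k m x1 {l} xs z p = begin
  Σ (suc m) (λ a → shiftedIntegrandCoeff k m x1 xs z p a * (invℕ (suc (m ℕ.+ a ℕ.+ p)) * powℚ z (suc (m ℕ.+ a ℕ.+ p))))
    ≡⟨ Σ-cong< (suc m) (λ a a<1+m → term a (ℕP.≤-pred a<1+m)) ⟩
  Σ (suc m) (λ a → F * (binomℚ m a * (sign a * invℕ (suc (m ℕ.+ p) ℕ.+ a))))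
    ≡⟨ *-distribˡ-Σ (suc m) F (λ a → binomℚ m a * (sign a * invℕ (suc (m ℕ.+ p) ℕ.+ a))) ⟨
  F * betaSum m (suc (m ℕ.+ p))
    ≡⟨ cong (F *_) (betaSum-closed m (m ℕ.+ p)) ⟩
  F * (ℕ→ℚ (m !) * invℕ (rising (suc (m ℕ.+ p)) (suc m)))
    ≡⟨ cong (λ e → F * (ℕ→ℚ (m !) * invℕ e)) (rising≡P m p) ⟩
  F * prefactor
    ≡⟨ solve 4 (λ c s z f → (c :* s :* z) :* f := (f :* (s :* c)) :* z) refl c (sign m) (powℚ z r) prefactor ⟩
  (prefactor * (sign m * c)) * powℚ z r
    ≡⟨ cong (λ e → (prefactor * e) * powℚ z r) sign*c≡Σsummand ⟩
  rhs k m r x1 xs * powℚ z r ∎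
  where
  r = suc (2 ℕ.* m) ℕ.+ p
  c = shiftedCoeff k m x1 xs p
  F = c * sign m * powℚ z r
  prefactor = ℕ→ℚ (m !) * invℕ (r P suc m)
  sign*c≡Σsummand : sign m * c ≡ sumTuples l m (summand k m r x1 xs)
  sign*c≡Σsummand = trans (*-distribˡ-sumTuples l m (sign m) _)
                          (sumTuples-cong l m (λ is → sym (summand-shifted k m x1 xs p is)))
  exponents : ∀ a → a ≤ m → (m ℕ.∸ a) ℕ.+ suc (m ℕ.+ a ℕ.+ p) ≡ r
  exponents a a≤m = begin
    (m ℕ.∸ a) ℕ.+ suc (m ℕ.+ a ℕ.+ p)       ≡⟨ rearrange (m ℕ.∸ a) m a p ⟩
    suc ((m ℕ.∸ a) ℕ.+ a ℕ.+ (m ℕ.+ p))     ≡⟨ cong (λ e → suc (e ℕ.+ (m ℕ.+ p))) (ℕP.m∸n+n≡m a≤m) ⟩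
    suc (m ℕ.+ (m ℕ.+ p))                   ≡⟨ double m p ⟩
    r                                       ∎
    where
    rearrange : ∀ d m a p → d ℕ.+ suc (m ℕ.+ a ℕ.+ p) ≡ suc (d ℕ.+ a ℕ.+ (m ℕ.+ p))
    rearrange = solve-∀
    double : ∀ m p → suc (m ℕ.+ (m ℕ.+ p)) ≡ suc (2 ℕ.* m) ℕ.+ p
    double = solve-∀
  reorder : ∀ m a p → m ℕ.+ a ℕ.+ p ≡ m ℕ.+ p ℕ.+ a
  reorder = solve-∀
  term : ∀ a → a ≤ m →
    shiftedIntegrandCoeff k m x1 xs z p a * (invℕ (suc (m ℕ.+ a ℕ.+ p)) * powℚ z (suc (m ℕ.+ a ℕ.+ p)))
      ≡ F * (binomℚ m a * (sign a * invℕ (suc (m ℕ.+ p) ℕ.+ a)))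
  term a a≤m = begin
    ((binomℚ m a * powℚ (- z) (m ℕ.∸ a)) * c) * (invℕ (suc (m ℕ.+ a ℕ.+ p)) * zᵇ)
      ≡⟨ cong₂ (λ u v → ((binomℚ m a * u) * c) * (invℕ (suc v) * zᵇ))
               (trans (powℚ-neg z (m ℕ.∸ a)) (cong (_* zᵃ) (sign-∸ m a a≤m))) (reorder m a p) ⟩
    ((binomℚ m a * ((sign m * sign a) * zᵃ)) * c) * (i * zᵇ)
      ≡⟨ solve 7 (λ C sm sa za c i zb → ((C :* ((sm :* sa) :* za)) :* c) :* (i :* zb) := (c :* sm :* (za :* zb)) :* (C :* (sa :* i)))
                 refl (binomℚ m a) (sign m) (sign a) zᵃ c i zᵇ ⟩
    (c * sign m * (zᵃ * zᵇ)) * (binomℚ m a * (sign a * i))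
      ≡⟨ cong (λ e → (c * sign m * e) * (binomℚ m a * (sign a * i)))
              (trans (sym (powℚ-+ z (m ℕ.∸ a) (suc (m ℕ.+ a ℕ.+ p)))) (cong (powℚ z) (exponents a a≤m))) ⟩
    F * (binomℚ m a * (sign a * i)) ∎
    where
    zᵃ = powℚ z (m ℕ.∸ a)
    zᵇ = powℚ z (suc (m ℕ.+ a ℕ.+ p))
    i = invℕ (suc (m ℕ.+ p) ℕ.+ a)

eval-Q≡Σrhs : ∀ k m x1 {l} (xs : Vec ℚ l) z →
  eval (Q k m x1 xs) z
    ≡ Σ (suc (k ℕ.+ m ℕ.* l)) (λ p → rhs k m (suc (2 ℕ.* m) ℕ.+ p) x1 xs * powℚ z (suc (2 ℕ.* m) ℕ.+ p))
eval-Q≡Σrhs k m x1 {l} xs z =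
  trans (eval-Q≡∫shiftedIntegrand k m x1 xs z)
  (trans (eval-antiderivℚ-shiftedIntegrand k m x1 xs z)
         (Σ-cong (suc (k ℕ.+ m ℕ.* l)) (integrated-terms≡rhs k m x1 xs z)))

eval-applyUpTo : ∀ n (f : ℕ → ℚ) z → eval (List.applyUpTo f n) z ≡ Σ n (λ r → f r * powℚ z r)
eval-applyUpTo zero    f z = refl
eval-applyUpTo (suc n) f z = begin
  f 0 + z * eval (List.applyUpTo (λ i → f (suc i)) n) z    ≡⟨ cong (λ e → f 0 + z * e) (eval-applyUpTo n (λ i → f (suc i)) z) ⟩
  f 0 + z * Σ n (λ r → f (suc r) * powℚ z r)
    ≡⟨ cong₂ _+_ (sym (ℚP.*-identityʳ (f 0)))
                 (trans (*-distribˡ-Σ n z (λ r → f (suc r) * powℚ z r))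
                        (Σ-cong n (λ r → solve 3 (λ z a b → z :* (a :* b) := a :* (z :* b)) refl z (f (suc r)) (powℚ z r)))) ⟩
  f 0 * 1ℚ + Σ n (λ r → f (suc r) * powℚ z (suc r))       ∎

coeff-applyUpTo-< : ∀ n (f : ℕ → ℚ) q → q ℕ.< n → coeff q (List.applyUpTo f n) ≡ f q
coeff-applyUpTo-< (suc n) f zero    _         = refl
coeff-applyUpTo-< (suc n) f (suc q) (s≤s q<n) = coeff-applyUpTo-< n (λ i → f (suc i)) q q<n

coeff-applyUpTo-≥ : ∀ n (f : ℕ → ℚ) q → n ≤ q → coeff q (List.applyUpTo f n) ≡ 0ℚ
coeff-applyUpTo-≥ zero    f q       _         = refl
coeff-applyUpTo-≥ (suc n) f (suc q) (s≤s n≤q) = coeff-applyUpTo-≥ n (λ i → f (suc i)) q n≤q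

rhs-vanishes : ∀ k m r x1 {l} (xs : Vec ℚ l) →
  (∀ is → binomShift (degK k m l is) r m ≡ 0) → rhs k m r x1 xs ≡ 0ℚ
rhs-vanishes k m r x1 {l} xs binom≡0 =
  trans (cong (prefactor *_) (sumTuples-zero l m (summand k m r x1 xs) summand≡0)) (ℚP.*-zeroʳ prefactor)
  where
  prefactor = ℕ→ℚ (m !) * invℕ (r P suc m)
  summand≡0 : ∀ is → summand k m r x1 xs is ≡ 0ℚ
  summand≡0 is = trans (cong (λ e → a * (b * (ℕ→ℚ e * c))) (binom≡0 is))
                       (solve 3 (λ a b c → a :* (b :* (con 0ℚ :* c)) := con 0ℚ) refl a b c)
    where
    a = sign (m ℕ.+ Vec.sum is)
    b = ℕ→ℚ (Vec.foldr _ ℕ._*_ 1 (Vec.map (m C_) is))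
    c = powℚ x1 (degK k m l is ℕ.∸ (r ℕ.∸ suc (2 ℕ.* m))) * Vec.foldr _ _*_ 1ℚ (Vec.zipWith powℚ xs is)

-- Q^{k,m} has degree at most 2m + 1 + (k + m l) in z, and its coefficients of z^0,…,z^{2m} vanish
rhsList : ∀ {l} → ℕ → ℕ → ℚ → Vec ℚ l → List ℚ
rhsList {l} k m x1 xs = List.applyUpTo (λ r → rhs k m r x1 xs) (suc (2 ℕ.* m) ℕ.+ suc (k ℕ.+ m ℕ.* l))

eval-rhsList : ∀ k m x1 {l} (xs : Vec ℚ l) z →
  eval (rhsList k m x1 xs) z
    ≡ Σ (suc (k ℕ.+ m ℕ.* l)) (λ p → rhs k m (suc (2 ℕ.* m) ℕ.+ p) x1 xs * powℚ z (suc (2 ℕ.* m) ℕ.+ p))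
eval-rhsList k m x1 {l} xs z = begin
  eval (rhsList k m x1 xs) z
    ≡⟨ eval-applyUpTo (suc (2 ℕ.* m) ℕ.+ suc (k ℕ.+ m ℕ.* l)) (λ r → rhs k m r x1 xs) z ⟩
  Σ (suc (2 ℕ.* m) ℕ.+ suc (k ℕ.+ m ℕ.* l)) f
    ≡⟨ Σ-split (suc (2 ℕ.* m)) (suc (k ℕ.+ m ℕ.* l)) f ⟩
  Σ (suc (2 ℕ.* m)) f + Σ (suc (k ℕ.+ m ℕ.* l)) (λ p → f (suc (2 ℕ.* m) ℕ.+ p))
    ≡⟨ cong (_+ Σ (suc (k ℕ.+ m ℕ.* l)) (λ p → f (suc (2 ℕ.* m) ℕ.+ p))) (Σ-zero (suc (2 ℕ.* m)) low-terms≡0) ⟩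
  0ℚ + Σ (suc (k ℕ.+ m ℕ.* l)) (λ p → f (suc (2 ℕ.* m) ℕ.+ p))
    ≡⟨ ℚP.+-identityˡ _ ⟩
  Σ (suc (k ℕ.+ m ℕ.* l)) (λ p → f (suc (2 ℕ.* m) ℕ.+ p)) ∎
  where
  f = λ r → rhs k m r x1 xs * powℚ z r
  low-terms≡0 : ∀ r → r ℕ.< suc (2 ℕ.* m) → f r ≡ 0ℚ
  low-terms≡0 r r<2m+1 =
    trans (cong (_* powℚ z r) (rhs-vanishes k m r x1 xs (λ is → binomShift-< _ r m r<2m+1))) (ℚP.*-zeroˡ (powℚ z r))

coeff-rhsList : ∀ k m x1 {l} (xs : Vec ℚ l) r → coeff r (rhsList k m x1 xs) ≡ rhs k m r x1 xs
coeff-rhsList k m x1 {l} xs r with r ℕ.<? suc (2 ℕ.* m) ℕ.+ suc (k ℕ.+ m ℕ.* l)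
... | yes r<len = coeff-applyUpTo-< _ (λ r → rhs k m r x1 xs) r r<len
... | no  r≮len = trans (coeff-applyUpTo-≥ len (λ r → rhs k m r x1 xs) r len≤r) (sym rhs≡0)
  where
  len = suc (2 ℕ.* m) ℕ.+ suc (k ℕ.+ m ℕ.* l)
  len≤r = ℕP.≮⇒≥ r≮len
  p = r ℕ.∸ suc (2 ℕ.* m)
  r≡2m+1+p : suc (2 ℕ.* m) ℕ.+ p ≡ r
  r≡2m+1+p = ℕP.m+[n∸m]≡n (ℕP.≤-trans (ℕP.m≤m+n (suc (2 ℕ.* m)) _) len≤r)
  N<p : k ℕ.+ m ℕ.* l ℕ.< p
  N<p = ℕP.+-cancelˡ-≤ (suc (2 ℕ.* m)) _ _ (subst (len ≤_) (sym r≡2m+1+p) len≤r)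
  rhs≡0 : rhs k m r x1 xs ≡ 0ℚ
  rhs≡0 = rhs-vanishes k m r x1 xs λ is →
    trans (cong (λ e → binomShift (degK k m l is) e m) (sym r≡2m+1+p))
          (trans (binomShift-+ (degK k m l is) m p)
                 (k>n⇒nCk≡0 (ℕP.≤-<-trans (ℕP.m∸n≤m (k ℕ.+ m ℕ.* l) (Vec.sum is)) N<p)))

theorem6p1 : (l k m : ℕ) (x1 : ℚ) (xs : Vec ℚ l) (r : ℕ) →
    suc m ≤ r →
    PZ.coeff r (Q k m x1 xs) ≡ rhs k m r x1 xs
theorem6p1 l k m x1 xs r _ = begin
  coeff r (Q k m x1 xs)         ≡⟨ eval≡⇒coeff≡ (Q k m x1 xs) (rhsList k m x1 xs) same-values r ⟩
  coeff r (rhsList k m x1 xs)   ≡⟨ coeff-rhsList k m x1 xs r ⟩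
  rhs k m r x1 xs               ∎
  where
  same-values : ∀ z → eval (Q k m x1 xs) z ≡ eval (rhsList k m x1 xs) z
  same-values z = trans (eval-Q≡Σrhs k m x1 xs z) (sym (eval-rhsList k m x1 xs z))
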